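{- For all integers $a,b$ and all integers $c\geqslant 0$, \[F(a,b,c)=F(a+1,b+1,c-1)+(qt)^cF(a+c,b-c)+\sum_{i=0}^{c-1}(qt)^{b+2c-2i}F(a-b-2c+4i).\]
   Context: Let $q,t$ be indeterminates. A standard Young tableau $T$ with $n$ boxes is a bijective filling of the Young diagram of a partition of $n$ by $1,\dots,n$, increasing along rows (left to right) and columns (bottom to top); rows $r$ counted from the bottom, columns $c$ from the left, starting at $1$. Let $z_i=q^{c-1}t^{r-1}$ where $i$ sits in row $r$, column $c$. Define \[\mathrm{wt}(T)=\prod_{i=2}^{n}\frac{1}{(1-z_i^{ -1})(1-qtz_{i-1}/z_i)}\prod_{1\leqslant i<j\leqslant n}\frac{(1-z_i/z_j)(1-qtz_i/z_j)}{(1-qz_i/z_j)(1-tz_i/z_j)},\] omitting any individual factor that vanishes, and for integers $a_2,\dots,a_n$ set $F(a_2,\dots,a_n)=\sum_T z_2^{a_2}\cdots z_n^{a_n}\mathrm{wt}(T)$ over all standard Young tableaux with $n$ boxes (a rational function). $F$ with three arguments uses $n=4$, with two $n=3$, with one $n=2$. -}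

module Defs where

open import Data.Bool using (Bool; true; false; _∧_; _∨_; not; if_then_else_)
open import Data.Nat as ℕ using (ℕ; zero; suc; _≡ᵇ_)
open import Data.Integer as ℤ using (ℤ; +_; -_; _-_; 0ℤ; 1ℤ)
open import Data.Bool.ListAction using (any)
open import Data.List using (List; []; _∷_; map; concatMap; _++_; foldr; length; drop; zipWith; upTo)
open import Data.Product using (_×_; _,_)
open import Relation.Nullary.Decidable using (⌊_⌋)
open import Relation.Binary.PropositionalEquality using (_≡_)

-- Laurent polynomials in q, t with integer coefficients:
-- a formal list of terms  coeff · q^i t^j  (i j : ℤ).

Mono : Set
Mono = ℤ × ℤ          -- (exponent of q , exponent of t)

LPoly : Set
LPoly = List (ℤ × Mono)

coeff : LPoly → ℤ → ℤ → ℤ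
coeff []                    i j = 0ℤ
coeff ((c , (e , f)) ∷ ps)  i j =
  (if ⌊ i ℤ.≟ e ⌋ ∧ ⌊ j ℤ.≟ f ⌋ then c else 0ℤ) ℤ.+ coeff ps i j

_≈P_ : LPoly → LPoly → Set
p ≈P p' = ∀ i j → coeff p i j ≡ coeff p' i j

monoMul : Mono → Mono → Mono
monoMul (a , b) (c , d) = (a ℤ.+ c , b ℤ.+ d)

monoDiv : Mono → Mono → Mono
monoDiv (a , b) (c , d) = (a - c , b - d)

monoPow : Mono → ℤ → Mono
monoPow (a , b) k = (k ℤ.* a , k ℤ.* b)

monoOne : Mono
monoOne = (0ℤ , 0ℤ)

pMono : Mono → LPoly
pMono m = (1ℤ , m) ∷ []

pOne : LPoly
pOne = pMono monoOne

pAdd : LPoly → LPoly → LPoly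
pAdd = _++_

pMul : LPoly → LPoly → LPoly
pMul p p' = concatMap (λ { (c , m) → map (λ { (c' , m') → (c ℤ.* c' , monoMul m m') }) p' }) p

pProd : List LPoly → LPoly
pProd = foldr pMul pOne

-- Rational functions in q, t: fractions num / den of Laurent polynomials
-- (all denominators arising below are nonzero products of factors 1 - m, m ≠ 1).

record RatFun : Set where
  constructor _/_
  field
    num : LPoly
    den : LPoly
open RatFun public

_≈R_ : RatFun → RatFun → Set
(n / d) ≈R (n' / d') = pMul n d' ≈P pMul n' d

infix 4 _≈R_ _≈P_

rZero : RatFun
rZero = [] / pOne

_+R_ : RatFun → RatFun → RatFun
(n / d) +R (n' / d') = pAdd (pMul n d') (pMul n' d) / pMul d d'

infixl 6 _+R_

monoR : Mono → RatFun → RatFun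
monoR m (n / d) = pMul (pMono m) n / d

rSum : List RatFun → RatFun
rSum = foldr _+R_ rZero

-- Standard Young tableaux (French convention).
-- A tableau with n boxes is the list of cells (row r , column c), r c ≥ 1,
-- occupied by the entries 1, 2, …, n in this order.

Cell : Set
Cell = ℕ × ℕ

cellEq : Cell → Cell → Bool
cellEq (r , c) (r' , c') = (r ≡ᵇ r') ∧ (c ≡ᵇ c')

elemCell : Cell → List Cell → Bool
elemCell x = any (cellEq x)

-- This says exactly: the occupied cells form a Young diagram (French) and
-- the filling increases along rows and up columns.
sytFrom : List Cell → List Cell → Bool
sytFrom earlier [] = true
sytFrom earlier ((r , c) ∷ rest) =
  not (elemCell (r , c) earlier)
  ∧ ((c ≡ᵇ 1) ∨ elemCell (r , ℕ.pred c) earlier)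
  ∧ ((r ≡ᵇ 1) ∨ elemCell (ℕ.pred r , c) earlier)
  ∧ sytFrom (earlier ++ ((r , c) ∷ [])) rest

isSYT : List Cell → Bool
isSYT = sytFrom []

filterB : {A : Set} → (A → Bool) → List A → List A
filterB p [] = []
filterB p (x ∷ xs) = if p x then x ∷ filterB p xs else filterB p xs

-- all cells (r , c) with 1 ≤ r , c ≤ n  (every SYT with n boxes lives here)
cellsUpTo : ℕ → List Cell
cellsUpTo n = concatMap (λ r → map (λ c → (suc r , suc c)) (upTo n)) (upTo n)

seqs : ℕ → List Cell → List (List Cell)
seqs zero    cs = [] ∷ []
seqs (suc k) cs = concatMap (λ x → map (x ∷_) (seqs k cs)) cs

SYTs : ℕ → List (List Cell)
SYTs n = filterB isSYT (seqs n (cellsUpTo n))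

zOf : Cell → Mono
zOf (r , c) = (+ ℕ.pred c , + ℕ.pred r)

mq mt mqt : Mono
mq  = (1ℤ , 0ℤ)
mt  = (0ℤ , 1ℤ)
mqt = (1ℤ , 1ℤ)

isOne : Mono → Bool
isOne (a , b) = ⌊ a ℤ.≟ 0ℤ ⌋ ∧ ⌊ b ℤ.≟ 0ℤ ⌋

factor : Mono → LPoly
factor m = if isOne m then pOne else ((1ℤ , monoOne) ∷ (- 1ℤ , m) ∷ [])

pairs : {A : Set} → List A → List (A × A)
pairs [] = []
pairs (x ∷ xs) = map (λ y → (x , y)) xs ++ pairs xs

consec : {A : Set} → List A → List (A × A)
consec [] = []
consec (x ∷ []) = []
consec (x ∷ y ∷ xs) = (x , y) ∷ consec (y ∷ xs)

wtNum : List Mono → LPoly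
wtNum zs = pProd (concatMap (λ { (zi , zj) →
             factor (monoDiv zi zj) ∷ factor (monoMul mqt (monoDiv zi zj)) ∷ [] }) (pairs zs))

wtDen : List Mono → LPoly
wtDen zs =
  pMul (pProd (map (λ zi → factor (monoDiv monoOne zi)) (drop 1 zs)))
  (pMul (pProd (map (λ { (zp , zi) → factor (monoMul mqt (monoDiv zp zi)) }) (consec zs)))
        (pProd (concatMap (λ { (zi , zj) →
             factor (monoMul mq (monoDiv zi zj)) ∷ factor (monoMul mt (monoDiv zi zj)) ∷ [] }) (pairs zs))))

wt : List Cell → RatFun
wt T = wtNum (map zOf T) / wtDen (map zOf T)

zPow : List ℤ → List Mono → Mono
zPow as zs = foldr monoMul monoOne (zipWith (λ a z → monoPow z a) as (drop 1 zs))

-- F(a_2, …, a_n), with n = 1 + (number of arguments)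
F : List ℤ → RatFun
F as = rSum (map (λ T → monoR (zPow as (map zOf T)) (wt T)) (SYTs (suc (length as))))

qtPow : ℤ → Mono
qtPow k = monoPow mqt k

sumBelow : ℕ → (ℕ → RatFun) → RatFun
sumBelow zero    f = rZero
sumBelow (suc c) f = sumBelow c f +R f c

-- F(a₂, …, aₙ) is a sum over the standard Young tableaux with n boxes of a monomial z^a times wt(T),
-- and after cancelling common factors 1 - m each weight is a small explicit rational function of q, t.
-- For each of the ten four-box tableaux, its term in F(a, b, c) minus its term in F(a + 1, b + 1, c - 1)
-- is, once the monomial of the tableau is factored out, an identity between constant rational
-- functions, decided by normalising polynomials. These defects are (qt)^c times the terms of
-- F(a + c, b - c) and four boundary terms, and the boundary terms are what the sum over i telescopes
-- to: its summands are the two-box terms, geometric in i.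
-- Rational functions are compared by cross-multiplication. This is transitive because every
-- denominator is a product of factors 1 - m with m ≠ 1, and 1 - m is not a zero divisor: a Laurent
-- polynomial killed by it would be periodic with finite support.

module Submission where

open import Algebra using (CommutativeMonoid; CommutativeSemiring)
open import Algebra.Structures.Biased using (IsCommutativeSemiringˡ)
open import Data.Bool using (Bool; true; false; _∧_; if_then_else_)
open import Data.Bool.Properties using (∧-zeroʳ)
open import Data.Integer using (ℤ; +_; -_; _-_; 0ℤ; 1ℤ; -1ℤ; _+_; _*_; ∣_∣; _≟_)
import Data.Integer.Properties as ℤ
open import Data.Integer.Tactic.RingSolver using (solve-∀)
open import Data.List using (List; []; _∷_; _++_; map; concatMap; drop; foldr; length; zipWith)
import Data.List.Properties as List
open import Data.List.Relation.Binary.Permutation.Propositional using (_↭_; ↭-sym; ↭-trans; ↭⇒↭ₛ′)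
open import Data.List.Relation.Binary.Permutation.Propositional.Properties using (map⁺)
import Data.List.Relation.Binary.Permutation.Setoid.Properties as Permutation
open import Data.List.Relation.Binary.Pointwise using (Pointwise; []; _∷_)
open import Data.List.Relation.Unary.All using (All; []; _∷_)
import Data.List.Sort.InsertionSort.Base as InsertionSort
import Data.List.Sort.InsertionSort.Properties as InsertionSortProperties
open import Data.Nat as ℕ using (ℕ; zero; suc; _≤_)
import Data.Nat.Properties as ℕ
open import Data.Product using (_×_; _,_; proj₁; proj₂)
open import Data.Product.Relation.Binary.Lex.NonStrict using (×-decTotalOrder)
open import Data.Sum using (_⊎_; inj₁; inj₂)
open import Function.Bundles using (_⇔_; mk⇔)
open import Level using (0ℓ)
open import Relation.Binary.Bundles using (DecTotalOrder; Setoid)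
open import Relation.Binary.PropositionalEquality
import Relation.Binary.Reasoning.Setoid as SetoidReasoning
open import Relation.Binary.Structures using (IsEquivalence)
open import Relation.Nullary using (¬_; yes; no)
open import Relation.Nullary.Decidable using (Dec; ⌊_⌋; does-⇔; isYes≗does; dec-false)

open import Defs

isAt : ℤ → ℤ → Mono → Bool
isAt i j (e , f) = ⌊ i ≟ e ⌋ ∧ ⌊ j ≟ f ⌋

coeffAt : ℤ × Mono → ℤ → ℤ → ℤ
coeffAt (c , m) i j = if isAt i j m then c else 0ℤ

private
  +-sub-cancelˡ : ∀ i y → y ≡ (i + y) - i
  +-sub-cancelˡ = solve-∀

  +-sub-cancelʳ : ∀ i a → i + a - a ≡ i
  +-sub-cancelʳ = solve-∀

  +-sub-inverse : ∀ i m → i ≡ m + (i - m)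
  +-sub-inverse = solve-∀

  sub-sub : ∀ i m → i - (i - m) ≡ m
  sub-sub = solve-∀

  sub-+ : ∀ i m e → i - (m + e) ≡ i - m - e
  sub-+ = solve-∀

  *-distrib-interchange : ∀ c a b x y → c * (a + b) + (x + y) ≡ c * a + x + (c * b + y)
  *-distrib-interchange = solve-∀

  +-zero-* : ∀ i a → i + 0ℤ * a ≡ i
  +-zero-* = solve-∀

  +-suc-* : ∀ i k a → i + (1ℤ + k) * a ≡ (i + k * a) + a
  +-suc-* = solve-∀

  one-minus : ∀ x y → 1ℤ * x + (- 1ℤ * y + 0ℤ) ≡ x - y
  one-minus = solve-∀

  plus-minus-one : ∀ x y → x + (- 1ℤ * y + 0ℤ) ≡ x - y
  plus-minus-one = solve-∀

  +-left-comm : ∀ x y z → x + (y + z) ≡ y + (x + z)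
  +-left-comm = solve-∀

  sub-exchange : ∀ x y x′ y′ → x - y ≡ x′ - y′ → x - x′ ≡ y - y′
  sub-exchange x y x′ y′ h = begin
    x - x′                           ≡⟨ regroup x y x′ y′ ⟩
    (x - y) - (x′ - y′) + (y - y′)   ≡⟨ cong (λ z → z - (x′ - y′) + (y - y′)) h ⟩
    (x′ - y′) - (x′ - y′) + (y - y′) ≡⟨ cong (_+ (y - y′)) (ℤ.+-inverseʳ (x′ - y′)) ⟩
    0ℤ + (y - y′)                    ≡⟨ ℤ.+-identityˡ (y - y′) ⟩
    y - y′                           ∎
    where
    open ≡-Reasoning
    regroup : ∀ x y x′ y′ → x - x′ ≡ (x - y) - (x′ - y′) + (y - y′)
    regroup = solve-∀

  ⌊⌋-⇔ : {A B : Set} → A ⇔ B → (a? : Dec A) (b? : Dec B) → ⌊ a? ⌋ ≡ ⌊ b? ⌋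
  ⌊⌋-⇔ A⇔B a? b? = trans (isYes≗does a?) (trans (does-⇔ A⇔B a? b?) (sym (isYes≗does b?)))

  ⌊⌋-false : {A : Set} (a? : Dec A) → ¬ A → ⌊ a? ⌋ ≡ false
  ⌊⌋-false a? ¬a = trans (isYes≗does a?) (dec-false a? ¬a)

  ≟-shift : ∀ i m e → ⌊ i ≟ m + e ⌋ ≡ ⌊ i - m ≟ e ⌋
  ≟-shift i m e = ⌊⌋-⇔ (mk⇔ to from) (i ≟ m + e) (i - m ≟ e)
    where
    to : i ≡ m + e → i - m ≡ e
    to refl = sym (+-sub-cancelˡ m e)
    from : i - m ≡ e → i ≡ m + e
    from refl = +-sub-inverse i m

  ≟-swap : ∀ i m e → ⌊ i - m ≟ e ⌋ ≡ ⌊ i - e ≟ m ⌋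
  ≟-swap i m e = ⌊⌋-⇔ (mk⇔ to from) (i - m ≟ e) (i - e ≟ m)
    where
    to : i - m ≡ e → i - e ≡ m
    to refl = sub-sub i m
    from : i - e ≡ m → i - m ≡ e
    from refl = sub-sub i e

  if-distribˡ : ∀ (b : Bool) c c′ → c * (if b then c′ else 0ℤ) ≡ (if b then c * c′ else 0ℤ)
  if-distribˡ true  c c′ = refl
  if-distribˡ false c c′ = ℤ.*-zeroʳ c

coeff-++ : ∀ p p′ i j → coeff (p ++ p′) i j ≡ coeff p i j + coeff p′ i j
coeff-++ []                  p′ i j = sym (ℤ.+-identityˡ _)
coeff-++ ((c , (e , f)) ∷ p) p′ i j =
  trans (cong (λ x → coeffAt (c , (e , f)) i j + x) (coeff-++ p p′ i j))
        (sym (ℤ.+-assoc (coeffAt (c , (e , f)) i j) _ _))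

coeff-shift : ∀ c m p i j → coeff (pMul ((c , m) ∷ []) p) i j ≡ c * coeff p (i - proj₁ m) (j - proj₂ m)
coeff-shift c m            []                   i j = sym (ℤ.*-zeroʳ c)
coeff-shift c (m₁ , m₂) ((c′ , (e , f)) ∷ p) i j = begin
  (if isAt i j (m₁ + e , m₂ + f) then c * c′ else 0ℤ) + coeff (pMul ((c , (m₁ , m₂)) ∷ []) p) i j
    ≡⟨ cong₂ _+_ here (coeff-shift c (m₁ , m₂) p i j) ⟩
  (if isAt (i - m₁) (j - m₂) (e , f) then c * c′ else 0ℤ) + c * coeff p (i - m₁) (j - m₂)
    ≡⟨ cong (_+ _) (sym (if-distribˡ (isAt (i - m₁) (j - m₂) (e , f)) c c′)) ⟩
  c * (if isAt (i - m₁) (j - m₂) (e , f) then c′ else 0ℤ) + c * coeff p (i - m₁) (j - m₂)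
    ≡⟨ sym (ℤ.*-distribˡ-+ c _ _) ⟩
  c * coeff ((c′ , (e , f)) ∷ p) (i - m₁) (j - m₂) ∎
  where
  open ≡-Reasoning
  here : (if isAt i j (m₁ + e , m₂ + f) then c * c′ else 0ℤ)
       ≡ (if isAt (i - m₁) (j - m₂) (e , f) then c * c′ else 0ℤ)
  here rewrite ≟-shift i m₁ e | ≟-shift j m₂ f = refl

infix 4 _≋_

-- A record wrapper around _≈P_, so that both polynomials can be inferred from an equation.
record _≋_ (p p′ : LPoly) : Set where
  constructor ≋-intro
  field coeff-≡ : p ≈P p′
open _≋_ public

≋-refl : ∀ {p} → p ≋ p
≋-refl = ≋-intro λ i j → refl

≋-sym : ∀ {p p′} → p ≋ p′ → p′ ≋ p
≋-sym e = ≋-intro λ i j → sym (coeff-≡ e i j)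

≋-trans : ∀ {p p′ p″} → p ≋ p′ → p′ ≋ p″ → p ≋ p″
≋-trans e e′ = ≋-intro λ i j → trans (coeff-≡ e i j) (coeff-≡ e′ i j)

≋-reflexive : ∀ {p p′} → p ≡ p′ → p ≋ p′
≋-reflexive refl = ≋-refl

≋-isEquivalence : IsEquivalence _≋_
≋-isEquivalence = record { refl = ≋-refl ; sym = ≋-sym ; trans = ≋-trans }

≋-setoid : Setoid 0ℓ 0ℓ
≋-setoid = record { isEquivalence = ≋-isEquivalence }

module ≋-Reasoning = SetoidReasoning ≋-setoid

convolution : LPoly → LPoly → ℤ → ℤ → ℤ
convolution []                  r i j = 0ℤ
convolution ((c , (e , f)) ∷ p) r i j = c * coeff r (i - e) (j - f) + convolution p r i j

pMul-∷ : ∀ x p r → pMul (x ∷ p) r ≡ pMul (x ∷ []) r ++ pMul p r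
pMul-∷ x p r = sym (List.++-assoc _ [] (pMul p r))

coeff-pMul : ∀ p r i j → coeff (pMul p r) i j ≡ convolution p r i j
coeff-pMul []                    r i j = refl
coeff-pMul (t@(c , (e , f)) ∷ p) r i j =
  trans (cong (λ s → coeff s i j) (pMul-∷ t p r))
        (trans (coeff-++ (pMul (t ∷ []) r) (pMul p r) i j)
               (cong₂ _+_ (coeff-shift c (e , f) r i j) (coeff-pMul p r i j)))

convolution-congʳ : ∀ p {r r′} → r ≋ r′ → ∀ i j → convolution p r i j ≡ convolution p r′ i j
convolution-congʳ []                  e i j = refl
convolution-congʳ ((c , (e′ , f)) ∷ p) e i j =
  cong₂ (λ x y → c * x + y) (coeff-≡ e (i - e′) (j - f)) (convolution-congʳ p e i j)

convolution-++ˡ : ∀ p p′ r i j → convolution (p ++ p′) r i j ≡ convolution p r i j + convolution p′ r i j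
convolution-++ˡ []                  p′ r i j = sym (ℤ.+-identityˡ _)
convolution-++ˡ ((c , (e , f)) ∷ p) p′ r i j =
  trans (cong (λ x → c * coeff r (i - e) (j - f) + x) (convolution-++ˡ p p′ r i j))
        (sym (ℤ.+-assoc (c * coeff r (i - e) (j - f)) _ _))

convolution-++ʳ : ∀ p r r′ i j → convolution p (r ++ r′) i j ≡ convolution p r i j + convolution p r′ i j
convolution-++ʳ []                  r r′ i j = refl
convolution-++ʳ ((c , (e , f)) ∷ p) r r′ i j
  rewrite coeff-++ r r′ (i - e) (j - f) | convolution-++ʳ p r r′ i j =
    *-distrib-interchange c _ _ _ _

convolution-[] : ∀ p i j → convolution p [] i j ≡ 0ℤ
convolution-[] []                  i j = refl
convolution-[] ((c , (e , f)) ∷ p) i j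
  rewrite convolution-[] p i j = trans (ℤ.+-identityʳ _) (ℤ.*-zeroʳ c)

convolution-term : ∀ p c m i j → convolution p ((c , m) ∷ []) i j ≡ c * coeff p (i - proj₁ m) (j - proj₂ m)
convolution-term []                   c m         i j = sym (ℤ.*-zeroʳ c)
convolution-term ((c′ , (e , f)) ∷ p) c (m₁ , m₂) i j
  rewrite convolution-term p c (m₁ , m₂) i j | ≟-swap i e m₁ | ≟-swap j f m₂ =
    trans (cong (_+ c * coeff p (i - m₁) (j - m₂)) (swap (isAt (i - m₁) (j - m₂) (e , f))))
          (sym (ℤ.*-distribˡ-+ c _ _))
  where
  swap : ∀ b → c′ * ((if b then c else 0ℤ) + 0ℤ) ≡ c * (if b then c′ else 0ℤ)
  swap true  = trans (cong (c′ *_) (ℤ.+-identityʳ c)) (ℤ.*-comm c′ c)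
  swap false = trans (ℤ.*-zeroʳ c′) (sym (ℤ.*-zeroʳ c))

convolution-comm : ∀ p r i j → convolution p r i j ≡ convolution r p i j
convolution-comm []                  r i j = sym (convolution-[] r i j)
convolution-comm ((c , (e , f)) ∷ p) r i j =
  sym (trans (convolution-++ʳ r ((c , (e , f)) ∷ []) p i j)
             (cong₂ _+_ (convolution-term r c (e , f) i j) (sym (convolution-comm p r i j))))

convolution-shift : ∀ c m q r i j →
  convolution (pMul ((c , m) ∷ []) q) r i j ≡ c * convolution q r (i - proj₁ m) (j - proj₂ m)
convolution-shift c m         []                   r i j = sym (ℤ.*-zeroʳ c)
convolution-shift c (m₁ , m₂) ((c′ , (e , f)) ∷ q) r i j
  rewrite sub-+ i m₁ e | sub-+ j m₂ f =
    trans (cong₂ _+_ (ℤ.*-assoc c c′ _) (convolution-shift c (m₁ , m₂) q r i j))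
          (sym (ℤ.*-distribˡ-+ c _ _))

convolution-assoc : ∀ p q r i j → convolution (pMul p q) r i j ≡ convolution p (pMul q r) i j
convolution-assoc []                    q r i j = refl
convolution-assoc (t@(c , (e , f)) ∷ p) q r i j
  rewrite pMul-∷ t p q
        | convolution-++ˡ (pMul (t ∷ []) q) (pMul p q) r i j
        | convolution-shift c (e , f) q r i j
        | convolution-assoc p q r i j
        | coeff-pMul q r (i - e) (j - f) = refl

pAdd-cong : ∀ {p p′ r r′} → p ≋ p′ → r ≋ r′ → pAdd p r ≋ pAdd p′ r′
pAdd-cong {p} {p′} {r} {r′} e e′ = ≋-intro λ i j →
  trans (coeff-++ p r i j) (trans (cong₂ _+_ (coeff-≡ e i j) (coeff-≡ e′ i j)) (sym (coeff-++ p′ r′ i j)))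

pAdd-assoc : ∀ p q r → pAdd (pAdd p q) r ≋ pAdd p (pAdd q r)
pAdd-assoc p q r = ≋-reflexive (List.++-assoc p q r)

pAdd-comm : ∀ p r → pAdd p r ≋ pAdd r p
pAdd-comm p r = ≋-intro λ i j →
  trans (coeff-++ p r i j) (trans (ℤ.+-comm (coeff p i j) (coeff r i j)) (sym (coeff-++ r p i j)))

pAdd-identityˡ : ∀ p → pAdd [] p ≋ p
pAdd-identityˡ p = ≋-refl

pAdd-identityʳ : ∀ p → pAdd p [] ≋ p
pAdd-identityʳ p = ≋-reflexive (List.++-identityʳ p)

pMul-comm : ∀ p r → pMul p r ≋ pMul r p
pMul-comm p r = ≋-intro λ i j →
  trans (coeff-pMul p r i j) (trans (convolution-comm p r i j) (sym (coeff-pMul r p i j)))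

pMul-congʳ : ∀ p {r r′} → r ≋ r′ → pMul p r ≋ pMul p r′
pMul-congʳ p {r} {r′} e = ≋-intro λ i j →
  trans (coeff-pMul p r i j) (trans (convolution-congʳ p e i j) (sym (coeff-pMul p r′ i j)))

pMul-cong : ∀ {p p′ r r′} → p ≋ p′ → r ≋ r′ → pMul p r ≋ pMul p′ r′
pMul-cong {p} {p′} {r} {r′} e e′ =
  ≋-trans (pMul-congʳ p e′) (≋-trans (pMul-comm p r′) (≋-trans (pMul-congʳ r′ e) (pMul-comm r′ p′)))

pMul-assoc : ∀ p q r → pMul (pMul p q) r ≋ pMul p (pMul q r)
pMul-assoc p q r = ≋-intro λ i j →
  trans (coeff-pMul (pMul p q) r i j) (trans (convolution-assoc p q r i j) (sym (coeff-pMul p (pMul q r) i j)))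

pMul-distribʳ : ∀ r p q → pMul (pAdd p q) r ≋ pAdd (pMul p r) (pMul q r)
pMul-distribʳ r p q = ≋-intro λ i j →
  trans (coeff-pMul (pAdd p q) r i j)
        (trans (convolution-++ˡ p q r i j)
               (trans (cong₂ _+_ (sym (coeff-pMul p r i j)) (sym (coeff-pMul q r i j)))
                      (sym (coeff-++ (pMul p r) (pMul q r) i j))))

pMul-identityˡ : ∀ p → pMul pOne p ≋ p
pMul-identityˡ p = ≋-intro λ i j →
  trans (coeff-pMul pOne p i j)
        (trans (ℤ.+-identityʳ _)
               (trans (ℤ.*-identityˡ _) (cong₂ (coeff p) (ℤ.+-identityʳ i) (ℤ.+-identityʳ j))))

pMul-identityʳ : ∀ p → pMul p pOne ≋ p
pMul-identityʳ p = ≋-trans (pMul-comm p pOne) (pMul-identityˡ p)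

pMul-zeroˡ : ∀ p → pMul [] p ≋ []
pMul-zeroˡ p = ≋-refl

laurentSemiring : CommutativeSemiring 0ℓ 0ℓ
laurentSemiring = record
  { Carrier = LPoly ; _≈_ = _≋_ ; _+_ = pAdd ; _*_ = pMul ; 0# = [] ; 1# = pOne
  ; isCommutativeSemiring = IsCommutativeSemiringˡ.isCommutativeSemiring (record
    { +-isCommutativeMonoid = record
      { isMonoid = record
        { isSemigroup = record
          { isMagma = record { isEquivalence = ≋-isEquivalence ; ∙-cong = pAdd-cong }
          ; assoc = pAdd-assoc }
        ; identity = pAdd-identityˡ , pAdd-identityʳ }
      ; comm = pAdd-comm }
    ; *-isCommutativeMonoid = record
      { isMonoid = record
        { isSemigroup = record
          { isMagma = record { isEquivalence = ≋-isEquivalence ; ∙-cong = pMul-cong }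
          ; assoc = pMul-assoc }
        ; identity = pMul-identityˡ , pMul-identityʳ }
      ; comm = pMul-comm }
    ; distribʳ = pMul-distribʳ
    ; zeroˡ = pMul-zeroˡ })
  }

open import Algebra.Solver.Ring.NaturalCoefficients.Default laurentSemiring
  using (_:+_; _:*_; _:=_; con) renaming (solve to solveᴾ)

OutsideBox : ℕ → ℤ → ℤ → Set
OutsideBox B i j = B ≤ ∣ i ∣ ⊎ B ≤ ∣ j ∣

OutsideBox-anti : ∀ {B B′ i j} → B ≤ B′ → OutsideBox B′ i j → OutsideBox B i j
OutsideBox-anti B≤B′ (inj₁ h) = inj₁ (ℕ.≤-trans B≤B′ h)
OutsideBox-anti B≤B′ (inj₂ h) = inj₂ (ℕ.≤-trans B≤B′ h)

supportBound : LPoly → ℕ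
supportBound []                  = 0
supportBound ((_ , (e , f)) ∷ p) = suc (∣ e ∣ ℕ.+ ∣ f ∣) ℕ.+ supportBound p

coeff-outsideSupport : ∀ p i j → OutsideBox (supportBound p) i j → coeff p i j ≡ 0ℤ
coeff-outsideSupport []                  i j out = refl
coeff-outsideSupport ((c , (e , f)) ∷ p) i j out =
  cong₂ _+_ (cong (λ b → if b then c else 0ℤ) (missed out))
            (coeff-outsideSupport p i j (OutsideBox-anti {i = i} {j} (ℕ.m≤n+m _ _) out))
  where
  below : ∀ {n} → n ℕ.≤ ∣ e ∣ ℕ.+ ∣ f ∣ → n ℕ.< supportBound ((c , (e , f)) ∷ p)
  below n≤ = ℕ.≤-trans (ℕ.s≤s n≤) (ℕ.m≤m+n _ (supportBound p))
  missed : OutsideBox (supportBound ((c , (e , f)) ∷ p)) i j → isAt i j (e , f) ≡ false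
  missed (inj₁ h) =
    cong (_∧ ⌊ j ≟ f ⌋) (⌊⌋-false (i ≟ e) λ { refl → ℕ.<⇒≱ (below (ℕ.m≤m+n ∣ e ∣ ∣ f ∣)) h })
  missed (inj₂ h) =
    trans (cong (⌊ i ≟ e ⌋ ∧_) (⌊⌋-false (j ≟ f) λ { refl → ℕ.<⇒≱ (below (ℕ.m≤n+m ∣ f ∣ ∣ e ∣)) h }))
          (∧-zeroʳ _)

large-multiple-escapes : ∀ B i x → x ≢ 0ℤ → B ≤ ∣ i + + (B ℕ.+ ∣ i ∣) * x ∣
large-multiple-escapes B i x x≢0 = ℕ.+-cancelʳ-≤ ∣ i ∣ B _ (begin
  B ℕ.+ ∣ i ∣                       ≤⟨ ℕ.m≤m*n (B ℕ.+ ∣ i ∣) ∣ x ∣ ⦃ ∣x∣-nonZero ⦄ ⟩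
  (B ℕ.+ ∣ i ∣) ℕ.* ∣ x ∣            ≡⟨ ℤ.∣i*j∣≡∣i∣*∣j∣ (+ (B ℕ.+ ∣ i ∣)) x ⟨
  ∣ + (B ℕ.+ ∣ i ∣) * x ∣            ≡⟨ cong ∣_∣ (+-sub-cancelˡ i _) ⟩
  ∣ (i + + (B ℕ.+ ∣ i ∣) * x) - i ∣  ≤⟨ ℤ.∣i-j∣≤∣i∣+∣j∣ (i + + (B ℕ.+ ∣ i ∣) * x) i ⟩
  ∣ i + + (B ℕ.+ ∣ i ∣) * x ∣ ℕ.+ ∣ i ∣ ∎)
  where
  open ℕ.≤-Reasoning
  ∣x∣-nonZero : ℕ.NonZero ∣ x ∣
  ∣x∣-nonZero = ℕ.≢-nonZero (λ ∣x∣≡0 → x≢0 (ℤ.∣i∣≡0⇒i≡0 ∣x∣≡0))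

periodic-iterate : ∀ (g : ℤ → ℤ → ℤ) {a b} → (∀ i j → g (i + a) (j + b) ≡ g i j) →
                   ∀ k i j → g (i + + k * a) (j + + k * b) ≡ g i j
periodic-iterate g {a} {b} period zero    i j = cong₂ g (+-zero-* i a) (+-zero-* j b)
periodic-iterate g {a} {b} period (suc k) i j =
  trans (cong₂ g (+-suc-* i (+ k) a) (+-suc-* j (+ k) b))
        (trans (period (i + + k * a) (j + + k * b)) (periodic-iterate g period k i j))

-- Translate the point along the period until it leaves the support.
periodic-finiteSupport⇒zero : ∀ (g : ℤ → ℤ → ℤ) B → (∀ i j → OutsideBox B i j → g i j ≡ 0ℤ) →
  ∀ {a b} → a ≢ 0ℤ ⊎ b ≢ 0ℤ → (∀ i j → g (i + a) (j + b) ≡ g i j) → ∀ i j → g i j ≡ 0ℤ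
periodic-finiteSupport⇒zero g B vanish (inj₁ a≢0) period i j =
  trans (sym (periodic-iterate g period (B ℕ.+ ∣ i ∣) i j))
        (vanish _ _ (inj₁ (large-multiple-escapes B i _ a≢0)))
periodic-finiteSupport⇒zero g B vanish (inj₂ b≢0) period i j =
  trans (sym (periodic-iterate g period (B ℕ.+ ∣ j ∣) i j))
        (vanish _ _ (inj₂ (large-multiple-escapes B j _ b≢0)))

Cancellative : LPoly → Set
Cancellative d = ∀ {p r} → pMul d p ≋ pMul d r → p ≋ r

pOne-cancellative : Cancellative pOne
pOne-cancellative {p} {r} e = ≋-trans (≋-sym (pMul-identityˡ p)) (≋-trans e (pMul-identityˡ r))

pMul-cancellative : ∀ {d d′} → Cancellative d → Cancellative d′ → Cancellative (pMul d d′)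
pMul-cancellative {d} {d′} cancel cancel′ {p} {r} e =
  cancel′ (cancel (≋-trans (≋-sym (pMul-assoc d d′ p)) (≋-trans e (pMul-assoc d d′ r))))

oneMinus : Mono → LPoly
oneMinus m = (1ℤ , monoOne) ∷ (- 1ℤ , m) ∷ []

coeff-oneMinus : ∀ a b p i j →
  coeff (pMul (oneMinus (a , b)) p) (i + a) (j + b) ≡ coeff p (i + a) (j + b) - coeff p i j
coeff-oneMinus a b p i j = begin
  coeff (pMul (oneMinus (a , b)) p) (i + a) (j + b)
    ≡⟨ coeff-pMul (oneMinus (a , b)) p (i + a) (j + b) ⟩
  1ℤ * coeff p (i + a - 0ℤ) (j + b - 0ℤ) + (- 1ℤ * coeff p (i + a - a) (j + b - b) + 0ℤ)
    ≡⟨ cong₂ (λ x y → 1ℤ * x + (- 1ℤ * y + 0ℤ))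
             (cong₂ (coeff p) (ℤ.+-identityʳ (i + a)) (ℤ.+-identityʳ (j + b)))
             (cong₂ (coeff p) (+-sub-cancelʳ i a) (+-sub-cancelʳ j b)) ⟩
  1ℤ * coeff p (i + a) (j + b) + (- 1ℤ * coeff p i j + 0ℤ)
    ≡⟨ one-minus (coeff p (i + a) (j + b)) (coeff p i j) ⟩
  coeff p (i + a) (j + b) - coeff p i j ∎
  where open ≡-Reasoning

-- (1 - m) p has the same coefficients as (1 - m) r, so p - r is invariant under the shift by m.
oneMinus-cancellative : ∀ a b → a ≢ 0ℤ ⊎ b ≢ 0ℤ → Cancellative (oneMinus (a , b))
oneMinus-cancellative a b m≢1 {p} {r} e =
  ≋-intro λ i j → ℤ.i-j≡0⇒i≡j _ _ (periodic-finiteSupport⇒zero difference bound vanish m≢1 period i j)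
  where
  difference : ℤ → ℤ → ℤ
  difference i j = coeff p i j - coeff r i j
  bound : ℕ
  bound = supportBound p ℕ.+ supportBound r
  vanish : ∀ i j → OutsideBox bound i j → difference i j ≡ 0ℤ
  vanish i j out = cong₂ _-_ (coeff-outsideSupport p i j (OutsideBox-anti {i = i} {j} (ℕ.m≤m+n _ _) out))
                             (coeff-outsideSupport r i j (OutsideBox-anti {i = i} {j} (ℕ.m≤n+m _ _) out))
  period : ∀ i j → difference (i + a) (j + b) ≡ difference i j
  period i j = sub-exchange (coeff p (i + a) (j + b)) (coeff p i j) (coeff r (i + a) (j + b)) (coeff r i j)
    (trans (sym (coeff-oneMinus a b p i j)) (trans (coeff-≡ e (i + a) (j + b)) (coeff-oneMinus a b r i j)))

factor-cancellative : ∀ m → Cancellative (factor m)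
factor-cancellative (a , b) e with a ≟ 0ℤ | b ≟ 0ℤ
... | yes _   | yes _   = pOne-cancellative e
... | yes _   | no b≢0  = oneMinus-cancellative a b (inj₂ b≢0) e
... | no a≢0  | _       = oneMinus-cancellative a b (inj₁ a≢0) e

infix 4 _≃_

-- A record wrapper around _≈R_, so that both rational functions can be inferred from an equation.
record _≃_ (x y : RatFun) : Set where
  constructor ≃-intro
  field cross-≋ : pMul (num x) (den y) ≋ pMul (num y) (den x)
open _≃_ public

≃-refl : ∀ {x} → x ≃ x
≃-refl = ≃-intro ≋-refl

≃-sym : ∀ {x y} → x ≃ y → y ≃ x
≃-sym e = ≃-intro (≋-sym (cross-≋ e))

-- _≈R_ is transitive only through a middle term whose denominator is not a zero divisor.
≃-trans : ∀ {x y z} → Cancellative (den y) → x ≃ y → y ≃ z → x ≃ z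
≃-trans {nx / dx} {ny / dy} {nz / dz} cancel (≃-intro e) (≃-intro e′) = ≃-intro (cancel (begin
  pMul dy (pMul nx dz) ≈⟨ solveᴾ 3 (λ a b c → a :* (b :* c) := (b :* a) :* c) ≋-refl dy nx dz ⟩
  pMul (pMul nx dy) dz ≈⟨ pMul-cong e ≋-refl ⟩
  pMul (pMul ny dx) dz ≈⟨ solveᴾ 3 (λ a b c → (b :* a) :* c := (b :* c) :* a) ≋-refl dx ny dz ⟩
  pMul (pMul ny dz) dx ≈⟨ pMul-cong e′ ≋-refl ⟩
  pMul (pMul nz dy) dx ≈⟨ solveᴾ 3 (λ a b c → (b :* a) :* c := a :* (b :* c)) ≋-refl dy nz dx ⟩
  pMul dy (pMul nz dx) ∎))
  where open ≋-Reasoning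

+R-cong : ∀ {x x′ y y′} → x ≃ x′ → y ≃ y′ → x +R y ≃ x′ +R y′
+R-cong {nx / dx} {nx′ / dx′} {ny / dy} {ny′ / dy′} (≃-intro e) (≃-intro e′) = ≃-intro (begin
  pMul (pAdd (pMul nx dy) (pMul ny dx)) (pMul dx′ dy′)
    ≈⟨ solveᴾ 6 (λ nx dx dx′ ny dy dy′ → (nx :* dy :+ ny :* dx) :* (dx′ :* dy′)
                   := (nx :* dx′) :* (dy :* dy′) :+ (ny :* dy′) :* (dx :* dx′)) ≋-refl nx dx dx′ ny dy dy′ ⟩
  pAdd (pMul (pMul nx dx′) (pMul dy dy′)) (pMul (pMul ny dy′) (pMul dx dx′))
    ≈⟨ pAdd-cong (pMul-cong e ≋-refl) (pMul-cong e′ ≋-refl) ⟩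
  pAdd (pMul (pMul nx′ dx) (pMul dy dy′)) (pMul (pMul ny′ dy) (pMul dx dx′))
    ≈⟨ solveᴾ 6 (λ nx′ dx dx′ ny′ dy dy′ → (nx′ :* dx) :* (dy :* dy′) :+ (ny′ :* dy) :* (dx :* dx′)
                   := (nx′ :* dy′ :+ ny′ :* dx′) :* (dx :* dy)) ≋-refl nx′ dx dx′ ny′ dy dy′ ⟩
  pMul (pAdd (pMul nx′ dy′) (pMul ny′ dx′)) (pMul dx dy) ∎)
  where open ≋-Reasoning

+R-comm : ∀ x y → x +R y ≃ y +R x
+R-comm (nx / dx) (ny / dy) = ≃-intro (solveᴾ 4 (λ nx dx ny dy →
  (nx :* dy :+ ny :* dx) :* (dy :* dx) := (ny :* dx :+ nx :* dy) :* (dx :* dy)) ≋-refl nx dx ny dy)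

+R-assoc : ∀ x y z → (x +R y) +R z ≃ x +R (y +R z)
+R-assoc (nx / dx) (ny / dy) (nz / dz) = ≃-intro (solveᴾ 6 (λ nx dx ny dy nz dz →
  ((nx :* dy :+ ny :* dx) :* dz :+ nz :* (dx :* dy)) :* (dx :* (dy :* dz))
  := (nx :* (dy :* dz) :+ (ny :* dz :+ nz :* dy) :* dx) :* ((dx :* dy) :* dz)) ≋-refl nx dx ny dy nz dz)

+R-identityˡ : ∀ x → rZero +R x ≃ x
+R-identityˡ (nx / dx) = ≃-intro (solveᴾ 2 (λ nx dx →
  (con 0 :* dx :+ nx :* con 1) :* dx := nx :* (con 1 :* dx)) ≋-refl nx dx)

+R-identityʳ : ∀ x → x +R rZero ≃ x
+R-identityʳ (nx / dx) = ≃-intro (solveᴾ 2 (λ nx dx →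
  (nx :* con 1 :+ con 0 :* dx) :* dx := nx :* (dx :* con 1)) ≋-refl nx dx)

+R-cancellative : ∀ x y → Cancellative (den x) → Cancellative (den y) → Cancellative (den (x +R y))
+R-cancellative (nx / dx) (ny / dy) = pMul-cancellative {dx} {dy}

monoR-cong : ∀ m {x y} → x ≃ y → monoR m x ≃ monoR m y
monoR-cong m {nx / dx} {ny / dy} (≃-intro e) = ≃-intro
  (≋-trans (pMul-assoc (pMono m) nx dy) (≋-trans (pMul-congʳ (pMono m) e) (≋-sym (pMul-assoc (pMono m) ny dx))))

monoR-distrib-+R : ∀ m x y → monoR m (x +R y) ≃ monoR m x +R monoR m y
monoR-distrib-+R m (nx / dx) (ny / dy) = ≃-intro (solveᴾ 5 (λ M nx dx ny dy →
  (M :* (nx :* dy :+ ny :* dx)) :* (dx :* dy) := ((M :* nx) :* dy :+ (M :* ny) :* dx) :* (dx :* dy))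
  ≋-refl (pMono m) nx dx ny dy)

monoR-monoR : ∀ m m′ x → monoR m (monoR m′ x) ≃ monoR (monoMul m m′) x
monoR-monoR m m′ (nx / dx) = ≃-intro (pMul-cong (≋-sym (pMul-assoc (pMono m) (pMono m′) nx)) ≋-refl)

monoR-rZero : ∀ m → monoR m rZero ≃ rZero
monoR-rZero m = ≃-intro (pMul-cong (pMul-comm (pMono m) []) (≋-refl {pOne}))

sumBelow-cong : ∀ c {f g} → (∀ i → f i ≃ g i) → sumBelow c f ≃ sumBelow c g
sumBelow-cong zero    e = ≃-refl
sumBelow-cong (suc c) e = +R-cong (sumBelow-cong c e) (e c)

addTerm : ℤ × Mono → LPoly → LPoly
addTerm t             []                = t ∷ []
addTerm t@(c , (a , b)) ((c′ , m′) ∷ p) =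
  if isAt a b m′ then (c + c′ , m′) ∷ p else (c′ , m′) ∷ addTerm t p

coeff-addTerm : ∀ t p i j → coeff (addTerm t p) i j ≡ coeff (t ∷ p) i j
coeff-addTerm (c , (a , b)) []                     i j = refl
coeff-addTerm (c , (a , b)) ((c′ , (a′ , b′)) ∷ p) i j with a ≟ a′ | b ≟ b′
... | yes refl | yes refl =
  trans (cong (_+ coeff p i j) (split (isAt i j (a , b))))
        (ℤ.+-assoc (coeffAt (c , (a , b)) i j) _ _)
  where
  split : ∀ h → (if h then c + c′ else 0ℤ) ≡ (if h then c else 0ℤ) + (if h then c′ else 0ℤ)
  split true  = refl
  split false = refl
... | yes refl | no _ = trans (cong (λ x → coeffAt (c′ , (a , b′)) i j + x) (coeff-addTerm (c , (a , b)) p i j))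
                             (+-left-comm (coeffAt (c′ , (a , b′)) i j) (coeffAt (c , (a , b)) i j) (coeff p i j))
... | no _     | _    = trans (cong (λ x → coeffAt (c′ , (a′ , b′)) i j + x) (coeff-addTerm (c , (a , b)) p i j))
                             (+-left-comm (coeffAt (c′ , (a′ , b′)) i j) (coeffAt (c , (a , b)) i j) (coeff p i j))

addTerms : LPoly → LPoly → LPoly
addTerms []      acc = acc
addTerms (t ∷ p) acc = addTerm t (addTerms p acc)

coeff-addTerms : ∀ p acc i j → coeff (addTerms p acc) i j ≡ coeff (p ++ acc) i j
coeff-addTerms []                  acc i j = refl
coeff-addTerms ((c , (a , b)) ∷ p) acc i j =
  trans (coeff-addTerm (c , (a , b)) (addTerms p acc) i j)
        (cong (λ x → coeffAt (c , (a , b)) i j + x) (coeff-addTerms p acc i j))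

-- Multiplication that merges like terms as it goes, to keep normal forms small.
pMulMerged : LPoly → LPoly → LPoly
pMulMerged []      r = []
pMulMerged (t ∷ p) r = addTerms (pMul (t ∷ []) r) (pMulMerged p r)

pMulMerged-≋ : ∀ p r → pMulMerged p r ≋ pMul p r
pMulMerged-≋ []      r = ≋-refl
pMulMerged-≋ (t ∷ p) r = ≋-intro λ i j → begin
  coeff (addTerms (pMul (t ∷ []) r) (pMulMerged p r)) i j
    ≡⟨ coeff-addTerms (pMul (t ∷ []) r) (pMulMerged p r) i j ⟩
  coeff (pMul (t ∷ []) r ++ pMulMerged p r) i j
    ≡⟨ coeff-≡ (pAdd-cong (≋-refl {pMul (t ∷ []) r}) (pMulMerged-≋ p r)) i j ⟩
  coeff (pMul (t ∷ []) r ++ pMul p r) i j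
    ≡⟨ cong (λ s → coeff s i j) (pMul-∷ t p r) ⟨
  coeff (pMul (t ∷ p) r) i j ∎
  where open ≡-Reasoning

infixl 6 _⊕_
infixl 7 _⊗_

data PolyExpr : Set where
  lit     : LPoly → PolyExpr
  _⊕_ _⊗_ : PolyExpr → PolyExpr → PolyExpr

⟪_⟫ : PolyExpr → LPoly
⟪ lit p ⟫ = p
⟪ e ⊕ e′ ⟫ = pAdd ⟪ e ⟫ ⟪ e′ ⟫
⟪ e ⊗ e′ ⟫ = pMul ⟪ e ⟫ ⟪ e′ ⟫

normalise : PolyExpr → LPoly
normalise (lit p)  = addTerms p []
normalise (e ⊕ e′) = addTerms (normalise e) (normalise e′)
normalise (e ⊗ e′) = pMulMerged (normalise e) (normalise e′)

normalise-≋ : ∀ e → normalise e ≋ ⟪ e ⟫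
normalise-≋ (lit p)  = ≋-intro λ i j → trans (coeff-addTerms p [] i j) (coeff-≡ (pAdd-identityʳ p) i j)
normalise-≋ (e ⊕ e′) = ≋-intro λ i j →
  trans (coeff-addTerms (normalise e) (normalise e′) i j)
        (coeff-≡ (pAdd-cong (normalise-≋ e) (normalise-≋ e′)) i j)
normalise-≋ (e ⊗ e′) =
  ≋-trans (pMulMerged-≋ (normalise e) (normalise e′)) (pMul-cong (normalise-≋ e) (normalise-≋ e′))

allCoeffsZero : LPoly → Bool
allCoeffsZero []            = true
allCoeffsZero ((c , m) ∷ p) = ⌊ c ≟ 0ℤ ⌋ ∧ allCoeffsZero p

allCoeffsZero-sound : ∀ p → allCoeffsZero p ≡ true → ∀ i j → coeff p i j ≡ 0ℤ
allCoeffsZero-sound []                  h i j = refl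
allCoeffsZero-sound ((c , (a , b)) ∷ p) h i j with c ≟ 0ℤ
... | yes refl = trans (cong (_+ coeff p i j) (if-same (isAt i j (a , b))))
                      (trans (ℤ.+-identityˡ _) (allCoeffsZero-sound p h i j))
  where
  if-same : ∀ h → (if h then 0ℤ else 0ℤ) ≡ 0ℤ
  if-same true  = refl
  if-same false = refl

pSub : LPoly → LPoly → LPoly
pSub p r = addTerms p (pMulMerged ((- 1ℤ , monoOne) ∷ []) r)

coeff-pSub : ∀ p r i j → coeff (pSub p r) i j ≡ coeff p i j - coeff r i j
coeff-pSub p r i j = begin
  coeff (pSub p r) i j                            ≡⟨ coeff-addTerms p _ i j ⟩
  coeff (p ++ pMulMerged minusOne r) i j          ≡⟨ coeff-++ p _ i j ⟩
  coeff p i j + coeff (pMulMerged minusOne r) i j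
    ≡⟨ cong (λ x → coeff p i j + x) (coeff-≡ (pMulMerged-≋ minusOne r) i j) ⟩
  coeff p i j + coeff (pMul minusOne r) i j       ≡⟨ cong (λ x → coeff p i j + x) (coeff-pMul minusOne r i j) ⟩
  coeff p i j + (- 1ℤ * coeff r (i - 0ℤ) (j - 0ℤ) + 0ℤ)
    ≡⟨ cong (λ x → coeff p i j + (- 1ℤ * x + 0ℤ)) (cong₂ (coeff r) (ℤ.+-identityʳ i) (ℤ.+-identityʳ j)) ⟩
  coeff p i j + (- 1ℤ * coeff r i j + 0ℤ)         ≡⟨ plus-minus-one (coeff p i j) (coeff r i j) ⟩
  coeff p i j - coeff r i j                       ∎
  where
  open ≡-Reasoning
  minusOne : LPoly
  minusOne = (- 1ℤ , monoOne) ∷ []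

_≈ᴾ?_ : PolyExpr → PolyExpr → Bool
e ≈ᴾ? e′ = allCoeffsZero (pSub (normalise e) (normalise e′))

≈ᴾ?-sound : ∀ e e′ → e ≈ᴾ? e′ ≡ true → ⟪ e ⟫ ≋ ⟪ e′ ⟫
≈ᴾ?-sound e e′ h = ≋-trans (≋-sym (normalise-≋ e)) (≋-trans (≋-intro agree) (normalise-≋ e′))
  where
  agree : ∀ i j → coeff (normalise e) i j ≡ coeff (normalise e′) i j
  agree i j = ℤ.i-j≡0⇒i≡j _ _ (trans (sym (coeff-pSub (normalise e) (normalise e′) i j))
                                     (allCoeffsZero-sound (pSub (normalise e) (normalise e′)) h i j))

factorProd : List Mono → LPoly
factorProd ms = pProd (map factor ms)

factorProd-cancellative : ∀ ms → Cancellative (factorProd ms)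
factorProd-cancellative []       = pOne-cancellative
factorProd-cancellative (m ∷ ms) =
  pMul-cancellative {factor m} {factorProd ms} (factor-cancellative m) (factorProd-cancellative ms)

factorProdᴱ : List Mono → PolyExpr
factorProdᴱ []       = lit pOne
factorProdᴱ (m ∷ ms) = lit (factor m) ⊗ factorProdᴱ ms

⟪factorProdᴱ⟫ : ∀ ms → ⟪ factorProdᴱ ms ⟫ ≡ factorProd ms
⟪factorProdᴱ⟫ []       = refl
⟪factorProdᴱ⟫ (m ∷ ms) = cong (pMul (factor m)) (⟪factorProdᴱ⟫ ms)

infixl 6 _+ᴱ_
infixr 7 _·ᴱ_
infix  8 _÷_

data RatExpr : Set where
  _÷_  : PolyExpr → List Mono → RatExpr
  _+ᴱ_ : RatExpr → RatExpr → RatExpr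
  _·ᴱ_ : Mono → RatExpr → RatExpr
  0ᴱ   : RatExpr

sumᴸ : List RatExpr → RatExpr
sumᴸ []       = 0ᴱ
sumᴸ (x ∷ xs) = x +ᴱ sumᴸ xs

sumBelowᴱ : ℕ → (ℕ → RatExpr) → RatExpr
sumBelowᴱ zero    f = 0ᴱ
sumBelowᴱ (suc c) f = sumBelowᴱ c f +ᴱ f c

numᴱ denᴱ : RatExpr → PolyExpr
numᴱ (p ÷ ms) = p
numᴱ (x +ᴱ y) = numᴱ x ⊗ denᴱ y ⊕ numᴱ y ⊗ denᴱ x
numᴱ (m ·ᴱ x) = lit (pMono m) ⊗ numᴱ x
numᴱ 0ᴱ       = lit []
denᴱ (p ÷ ms) = factorProdᴱ ms
denᴱ (x +ᴱ y) = denᴱ x ⊗ denᴱ y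
denᴱ (m ·ᴱ x) = denᴱ x
denᴱ 0ᴱ       = lit pOne

_≈ᴿ?_ : RatExpr → RatExpr → Bool
x ≈ᴿ? y = (numᴱ x ⊗ denᴱ y) ≈ᴾ? (numᴱ y ⊗ denᴱ x)

-- The denotation is opaque: unfolding it lets the type checker expand products of many
-- denominators when it compares large expressions.
opaque
  ⟦_⟧ : RatExpr → RatFun
  ⟦ p ÷ ms ⟧ = ⟪ p ⟫ / factorProd ms
  ⟦ x +ᴱ y ⟧ = ⟦ x ⟧ +R ⟦ y ⟧
  ⟦ m ·ᴱ x ⟧ = monoR m ⟦ x ⟧
  ⟦ 0ᴱ ⟧     = rZero

  ⟦⟧-cancellative : ∀ x → Cancellative (den ⟦ x ⟧)
  ⟦⟧-cancellative (p ÷ ms) = factorProd-cancellative ms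
  ⟦⟧-cancellative (x +ᴱ y) = +R-cancellative ⟦ x ⟧ ⟦ y ⟧ (⟦⟧-cancellative x) (⟦⟧-cancellative y)
  ⟦⟧-cancellative (m ·ᴱ x) = ⟦⟧-cancellative x
  ⟦⟧-cancellative 0ᴱ       = pOne-cancellative

  ⟪numᴱ⟫ : ∀ x → ⟪ numᴱ x ⟫ ≡ num ⟦ x ⟧
  ⟪denᴱ⟫ : ∀ x → ⟪ denᴱ x ⟫ ≡ den ⟦ x ⟧
  ⟪numᴱ⟫ (p ÷ ms) = refl
  ⟪numᴱ⟫ (x +ᴱ y) =
    cong₂ pAdd (cong₂ pMul (⟪numᴱ⟫ x) (⟪denᴱ⟫ y)) (cong₂ pMul (⟪numᴱ⟫ y) (⟪denᴱ⟫ x))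
  ⟪numᴱ⟫ (m ·ᴱ x) = cong (pMul (pMono m)) (⟪numᴱ⟫ x)
  ⟪numᴱ⟫ 0ᴱ       = refl
  ⟪denᴱ⟫ (p ÷ ms) = ⟪factorProdᴱ⟫ ms
  ⟪denᴱ⟫ (x +ᴱ y) = cong₂ pMul (⟪denᴱ⟫ x) (⟪denᴱ⟫ y)
  ⟪denᴱ⟫ (m ·ᴱ x) = ⟪denᴱ⟫ x
  ⟪denᴱ⟫ 0ᴱ       = refl

  ⟦÷⟧ : ∀ p ms → ⟦ p ÷ ms ⟧ ≡ ⟪ p ⟫ / factorProd ms
  ⟦÷⟧ p ms = refl

  ⟦⟧-+ᴱ : ∀ {x y X Y} → ⟦ x ⟧ ≃ X → ⟦ y ⟧ ≃ Y → ⟦ x +ᴱ y ⟧ ≃ X +R Y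
  ⟦⟧-+ᴱ e e′ = +R-cong e e′

  ⟦⟧-·ᴱ : ∀ m {x X} → ⟦ x ⟧ ≃ X → ⟦ m ·ᴱ x ⟧ ≃ monoR m X
  ⟦⟧-·ᴱ m e = monoR-cong m e

  ⟦⟧-0ᴱ : ⟦ 0ᴱ ⟧ ≃ rZero
  ⟦⟧-0ᴱ = ≃-refl

≈ᴿ?-sound : ∀ x y → x ≈ᴿ? y ≡ true → ⟦ x ⟧ ≃ ⟦ y ⟧
≈ᴿ?-sound x y h = ≃-intro (subst₂ _≋_
  (cong₂ pMul (⟪numᴱ⟫ x) (⟪denᴱ⟫ y)) (cong₂ pMul (⟪numᴱ⟫ y) (⟪denᴱ⟫ x))
  (≈ᴾ?-sound (numᴱ x ⊗ denᴱ y) (numᴱ y ⊗ denᴱ x) h))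

⟦⟧-sumBelowᴱ : ∀ c {f g} → (∀ i → ⟦ f i ⟧ ≃ g i) → ⟦ sumBelowᴱ c f ⟧ ≃ sumBelow c g
⟦⟧-sumBelowᴱ zero    e = ⟦⟧-0ᴱ
⟦⟧-sumBelowᴱ (suc c) e = ⟦⟧-+ᴱ (⟦⟧-sumBelowᴱ c e) (e c)

≃-via : ∀ {x z} e → x ≃ ⟦ e ⟧ → ⟦ e ⟧ ≃ z → x ≃ z
≃-via e = ≃-trans (⟦⟧-cancellative e)

infix 4 _≈ᴱ_

record _≈ᴱ_ (x y : RatExpr) : Set where
  constructor ≈ᴱ-intro
  field ≈ᴱ⇒≃ : ⟦ x ⟧ ≃ ⟦ y ⟧
open _≈ᴱ_ public

≈ᴱ-refl : ∀ {x} → x ≈ᴱ x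
≈ᴱ-refl = ≈ᴱ-intro ≃-refl

≈ᴱ-sym : ∀ {x y} → x ≈ᴱ y → y ≈ᴱ x
≈ᴱ-sym (≈ᴱ-intro e) = ≈ᴱ-intro (≃-sym e)

≈ᴱ-trans : ∀ {x y z} → x ≈ᴱ y → y ≈ᴱ z → x ≈ᴱ z
≈ᴱ-trans {y = y} (≈ᴱ-intro e) (≈ᴱ-intro e′) = ≈ᴱ-intro (≃-via y e e′)

≈ᴱ-isEquivalence : IsEquivalence _≈ᴱ_
≈ᴱ-isEquivalence = record { refl = ≈ᴱ-refl ; sym = ≈ᴱ-sym ; trans = ≈ᴱ-trans }

≈ᴱ-check : ∀ x y → x ≈ᴿ? y ≡ true → x ≈ᴱ y
≈ᴱ-check x y h = ≈ᴱ-intro (≈ᴿ?-sound x y h)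

opaque
  unfolding ⟦_⟧

  +ᴱ-cong : ∀ {x x′ y y′} → x ≈ᴱ x′ → y ≈ᴱ y′ → x +ᴱ y ≈ᴱ x′ +ᴱ y′
  +ᴱ-cong (≈ᴱ-intro e) (≈ᴱ-intro e′) = ≈ᴱ-intro (+R-cong e e′)

  +ᴱ-assoc : ∀ x y z → (x +ᴱ y) +ᴱ z ≈ᴱ x +ᴱ (y +ᴱ z)
  +ᴱ-assoc x y z = ≈ᴱ-intro (+R-assoc ⟦ x ⟧ ⟦ y ⟧ ⟦ z ⟧)

  +ᴱ-identityˡ : ∀ x → 0ᴱ +ᴱ x ≈ᴱ x
  +ᴱ-identityˡ x = ≈ᴱ-intro (+R-identityˡ ⟦ x ⟧)

  +ᴱ-identityʳ : ∀ x → x +ᴱ 0ᴱ ≈ᴱ x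
  +ᴱ-identityʳ x = ≈ᴱ-intro (+R-identityʳ ⟦ x ⟧)

  +ᴱ-comm : ∀ x y → x +ᴱ y ≈ᴱ y +ᴱ x
  +ᴱ-comm x y = ≈ᴱ-intro (+R-comm ⟦ x ⟧ ⟦ y ⟧)

  ·ᴱ-cong : ∀ m {x y} → x ≈ᴱ y → m ·ᴱ x ≈ᴱ m ·ᴱ y
  ·ᴱ-cong m (≈ᴱ-intro e) = ≈ᴱ-intro (monoR-cong m e)

  ·ᴱ-distrib-+ᴱ : ∀ m x y → m ·ᴱ (x +ᴱ y) ≈ᴱ m ·ᴱ x +ᴱ m ·ᴱ y
  ·ᴱ-distrib-+ᴱ m x y = ≈ᴱ-intro (monoR-distrib-+R m ⟦ x ⟧ ⟦ y ⟧)

  ·ᴱ-assoc : ∀ m m′ x → m ·ᴱ m′ ·ᴱ x ≈ᴱ monoMul m m′ ·ᴱ x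
  ·ᴱ-assoc m m′ x = ≈ᴱ-intro (monoR-monoR m m′ ⟦ x ⟧)

  ·ᴱ-zeroʳ : ∀ m → m ·ᴱ 0ᴱ ≈ᴱ 0ᴱ
  ·ᴱ-zeroʳ m = ≈ᴱ-intro (monoR-rZero m)

·ᴱ-congˡ : ∀ {m m′} x → m ≡ m′ → m ·ᴱ x ≈ᴱ m′ ·ᴱ x
·ᴱ-congˡ x refl = ≈ᴱ-refl

ratExprMonoid : CommutativeMonoid 0ℓ 0ℓ
ratExprMonoid = record
  { Carrier = RatExpr ; _≈_ = _≈ᴱ_ ; _∙_ = _+ᴱ_ ; ε = 0ᴱ
  ; isCommutativeMonoid = record
    { isMonoid = record
      { isSemigroup = record
        { isMagma = record { isEquivalence = ≈ᴱ-isEquivalence ; ∙-cong = +ᴱ-cong }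
        ; assoc = +ᴱ-assoc }
      ; identity = +ᴱ-identityˡ , +ᴱ-identityʳ }
    ; comm = +ᴱ-comm } }

module ≈ᴱ-Reasoning = SetoidReasoning (CommutativeMonoid.setoid ratExprMonoid)

open import Algebra.Solver.CommutativeMonoid ratExprMonoid
  using (_⊜_) renaming (solve to solveᴱ; _⊕_ to _⊞_; id to ∅)

monoOrder : DecTotalOrder 0ℓ 0ℓ 0ℓ
monoOrder = ×-decTotalOrder ℤ.≤-decTotalOrder ℤ.≤-decTotalOrder

open InsertionSort monoOrder using (sort)
open InsertionSortProperties monoOrder using (sort-↭)

factorProd-↭ : ∀ {ms ms′} → ms ↭ ms′ → factorProd ms ≋ factorProd ms′
factorProd-↭ ms↭ms′ = Permutation.foldr-commMonoid ≋-setoid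
  (CommutativeSemiring.*-isCommutativeMonoid laurentSemiring) (↭⇒↭ₛ′ ≋-isEquivalence (map⁺ factor ms↭ms′))

factorProd-sort : ∀ ms ms′ → sort ms ≡ sort ms′ → factorProd ms ≋ factorProd ms′
factorProd-sort ms ms′ eq =
  factorProd-↭ (↭-trans (↭-sym (sort-↭ ms)) (subst (_↭ ms′) (sym eq) (sort-↭ ms′)))

factorProd-++ : ∀ ms ms′ → factorProd (ms ++ ms′) ≋ pMul (factorProd ms) (factorProd ms′)
factorProd-++ []       ms′ = ≋-sym (pMul-identityˡ (factorProd ms′))
factorProd-++ (m ∷ ms) ms′ =
  ≋-trans (pMul-congʳ (factor m) (factorProd-++ ms ms′))
          (≋-sym (pMul-assoc (factor m) (factorProd ms) (factorProd ms′)))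

wtNumFactors wtDenFactors : List Mono → List Mono
wtNumFactors zs = concatMap (λ { (zi , zj) → monoDiv zi zj ∷ monoMul mqt (monoDiv zi zj) ∷ [] }) (pairs zs)
wtDenFactors zs =
  map (monoDiv monoOne) (drop 1 zs)
  ++ map (λ { (zp , zi) → monoMul mqt (monoDiv zp zi) }) (consec zs)
  ++ concatMap (λ { (zi , zj) → monoMul mq (monoDiv zi zj) ∷ monoMul mt (monoDiv zi zj) ∷ [] }) (pairs zs)

pProd-map-factor : ∀ {A : Set} (f : A → Mono) {g : A → LPoly} →
  (∀ x → g x ≡ factor (f x)) → ∀ xs → pProd (map g xs) ≡ factorProd (map f xs)
pProd-map-factor f g≡ xs = cong pProd (trans (List.map-cong g≡ xs) (List.map-∘ xs))

pProd-concatMap-factor : ∀ {A : Set} (f : A → List Mono) {g : A → List LPoly} →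
  (∀ x → g x ≡ map factor (f x)) → ∀ xs → pProd (concatMap g xs) ≡ factorProd (concatMap f xs)
pProd-concatMap-factor f g≡ xs =
  cong pProd (sym (trans (List.map-concatMap factor f xs) (List.concatMap-cong (λ x → sym (g≡ x)) xs)))

wtNum-factorProd : ∀ zs → wtNum zs ≡ factorProd (wtNumFactors zs)
wtNum-factorProd zs = pProd-concatMap-factor _ (λ { (_ , _) → refl }) (pairs zs)

wtDen-factorProd : ∀ zs → wtDen zs ≋ factorProd (wtDenFactors zs)
wtDen-factorProd zs = begin
  wtDen zs
    ≡⟨ cong₂ pMul (pProd-map-factor (monoDiv monoOne) (λ _ → refl) (drop 1 zs))
                  (cong₂ pMul (pProd-map-factor _ (λ { (_ , _) → refl }) (consec zs))
                              (pProd-concatMap-factor _ (λ { (_ , _) → refl }) (pairs zs))) ⟩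
  pMul (factorProd D₁) (pMul (factorProd D₂) (factorProd D₃))
    ≈⟨ pMul-congʳ (factorProd D₁) (factorProd-++ D₂ D₃) ⟨
  pMul (factorProd D₁) (factorProd (D₂ ++ D₃))
    ≈⟨ factorProd-++ D₁ (D₂ ++ D₃) ⟨
  factorProd (wtDenFactors zs) ∎
  where
  open ≋-Reasoning
  D₁ D₂ D₃ : List Mono
  D₁ = map (monoDiv monoOne) (drop 1 zs)
  D₂ = map (λ { (zp , zi) → monoMul mqt (monoDiv zp zi) }) (consec zs)
  D₃ = concatMap (λ { (zi , zj) → monoMul mq (monoDiv zi zj) ∷ monoMul mt (monoDiv zi zj) ∷ [] }) (pairs zs)

record SimplifiedSYT : Set where
  constructor syt
  field
    cells      : List Cell
    numFactors : List Mono
    denFactors : List Mono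
open SimplifiedSYT public

zsOf : SimplifiedSYT → List Mono
zsOf s = map zOf (cells s)

weightᴱ : SimplifiedSYT → RatExpr
weightᴱ s = factorProdᴱ (numFactors s) ÷ denFactors s

-- Cross-multiplied with wt, both sides are the same multiset of factors 1 - m.
Simplifies : SimplifiedSYT → Set
Simplifies s = sort (wtNumFactors (zsOf s) ++ denFactors s) ≡ sort (numFactors s ++ wtDenFactors (zsOf s))

weightᴱ-denotes-wt : ∀ s → Simplifies s → ⟦ weightᴱ s ⟧ ≃ wt (cells s)
weightᴱ-denotes-wt s@(syt T N D) h = subst (_≃ wt T) (sym (⟦÷⟧ (factorProdᴱ N) D)) (≃-intro (begin
  pMul ⟪ factorProdᴱ N ⟫ (wtDen zs)
    ≈⟨ pMul-cong (≋-reflexive (⟪factorProdᴱ⟫ N)) (wtDen-factorProd zs) ⟩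
  pMul (factorProd N) (factorProd (wtDenFactors zs))
    ≈⟨ factorProd-++ N (wtDenFactors zs) ⟨
  factorProd (N ++ wtDenFactors zs)
    ≈⟨ factorProd-sort (wtNumFactors zs ++ D) (N ++ wtDenFactors zs) h ⟨
  factorProd (wtNumFactors zs ++ D)
    ≈⟨ factorProd-++ (wtNumFactors zs) D ⟩
  pMul (factorProd (wtNumFactors zs)) (factorProd D)
    ≡⟨ cong (λ n → pMul n (factorProd D)) (wtNum-factorProd zs) ⟨
  pMul (wtNum zs) (factorProd D) ∎))
  where
  open ≋-Reasoning
  zs : List Mono
  zs = map zOf T

term : List ℤ → SimplifiedSYT → RatExpr
term as s = zPow as (zsOf s) ·ᴱ weightᴱ s

Fᴱ : List ℤ → List SimplifiedSYT → RatExpr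
Fᴱ as ss = sumᴸ (map (term as) ss)

Fᴱ-denotes-F : ∀ as ss → SYTs (suc (length as)) ≡ map cells ss → All Simplifies ss →
               ⟦ Fᴱ as ss ⟧ ≃ F as
Fᴱ-denotes-F as ss eq hs rewrite eq = go ss hs
  where
  go : ∀ ss → All Simplifies ss →
       ⟦ Fᴱ as ss ⟧ ≃ rSum (map (λ T → monoR (zPow as (map zOf T)) (wt T)) (map cells ss))
  go []       []       = ⟦⟧-0ᴱ
  go (s ∷ ss) (h ∷ hs) = ⟦⟧-+ᴱ (⟦⟧-·ᴱ (zPow as (zsOf s)) (weightᴱ-denotes-wt s h)) (go ss hs)

-- A denominator factor (0 , 0) is a vanishing factor 1 - q zᵢ/zⱼ or 1 - t zᵢ/zⱼ of wt, which is omitted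
-- there (factor (0 , 0) = 1); it is listed so that the multisets of factors match.
syt2₀ syt2₁ : SimplifiedSYT
syt2₀ = syt ((1 , 1) ∷ (1 , 2) ∷ []) [] ((+ 0 , + 0) ∷ (-1ℤ , + 1) ∷ [])
syt2₁ = syt ((1 , 1) ∷ (2 , 1) ∷ []) [] ((+ 0 , + 0) ∷ (+ 1 , -1ℤ) ∷ [])

syt3₀ syt3₁ syt3₂ syt3₃ : SimplifiedSYT
syt3₀ = syt ((1 , 1) ∷ (1 , 2) ∷ (1 , 3) ∷ []) []
            ((+ 0 , + 0) ∷ (+ 0 , + 0) ∷ (-1ℤ , + 1) ∷ (- + 2 , + 1) ∷ [])
syt3₁ = syt ((1 , 1) ∷ (1 , 2) ∷ (2 , 1) ∷ []) []
            ((+ 0 , + 0) ∷ (+ 0 , + 0) ∷ (-1ℤ , + 1) ∷ (+ 2 , -1ℤ) ∷ [])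
syt3₂ = syt ((1 , 1) ∷ (2 , 1) ∷ (1 , 2) ∷ []) []
            ((+ 0 , + 0) ∷ (+ 0 , + 0) ∷ (+ 1 , -1ℤ) ∷ (-1ℤ , + 2) ∷ [])
syt3₃ = syt ((1 , 1) ∷ (2 , 1) ∷ (3 , 1) ∷ []) []
            ((+ 0 , + 0) ∷ (+ 0 , + 0) ∷ (+ 1 , -1ℤ) ∷ (+ 1 , - + 2) ∷ [])

syt4₀ syt4₁ syt4₂ syt4₃ syt4₄ syt4₅ syt4₆ syt4₇ syt4₈ syt4₉ : SimplifiedSYT
syt4₀ = syt ((1 , 1) ∷ (1 , 2) ∷ (1 , 3) ∷ (1 , 4) ∷ []) []
            ((+ 0 , + 0) ∷ (+ 0 , + 0) ∷ (+ 0 , + 0) ∷ (-1ℤ , + 1) ∷ (- + 2 , + 1) ∷ (- + 3 , + 1) ∷ [])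
syt4₁ = syt ((1 , 1) ∷ (1 , 2) ∷ (1 , 3) ∷ (2 , 1) ∷ []) []
            ((+ 0 , + 0) ∷ (+ 0 , + 0) ∷ (+ 0 , + 0) ∷ (-1ℤ , + 1) ∷ (- + 2 , + 1) ∷ (+ 3 , -1ℤ) ∷ [])
syt4₂ = syt ((1 , 1) ∷ (1 , 2) ∷ (2 , 1) ∷ (1 , 3) ∷ []) ((+ 0 , + 1) ∷ [])
            ((+ 0 , + 0) ∷ (+ 0 , + 0) ∷ (+ 0 , + 0) ∷ (-1ℤ , + 1) ∷ (-1ℤ , + 1) ∷ (+ 2 , -1ℤ) ∷ (- + 2 , + 2) ∷ [])
syt4₃ = syt ((1 , 1) ∷ (1 , 2) ∷ (2 , 1) ∷ (2 , 2) ∷ []) ((+ 1 , + 0) ∷ [])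
            ((+ 0 , + 0) ∷ (+ 0 , + 0) ∷ (+ 0 , + 0) ∷ (-1ℤ , + 1) ∷ (-1ℤ , + 1) ∷ (+ 1 , -1ℤ) ∷ (+ 2 , -1ℤ) ∷ [])
syt4₄ = syt ((1 , 1) ∷ (1 , 2) ∷ (2 , 1) ∷ (3 , 1) ∷ []) []
            ((+ 0 , + 0) ∷ (+ 0 , + 0) ∷ (+ 0 , + 0) ∷ (-1ℤ , + 1) ∷ (+ 1 , -1ℤ) ∷ (+ 2 , - + 2) ∷ [])
syt4₅ = syt ((1 , 1) ∷ (2 , 1) ∷ (1 , 2) ∷ (1 , 3) ∷ []) []
            ((+ 0 , + 0) ∷ (+ 0 , + 0) ∷ (+ 0 , + 0) ∷ (+ 1 , -1ℤ) ∷ (-1ℤ , + 1) ∷ (- + 2 , + 2) ∷ [])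
syt4₆ = syt ((1 , 1) ∷ (2 , 1) ∷ (1 , 2) ∷ (2 , 2) ∷ []) ((+ 0 , + 1) ∷ [])
            ((+ 0 , + 0) ∷ (+ 0 , + 0) ∷ (+ 0 , + 0) ∷ (+ 1 , -1ℤ) ∷ (+ 1 , -1ℤ) ∷ (-1ℤ , + 1) ∷ (-1ℤ , + 2) ∷ [])
syt4₇ = syt ((1 , 1) ∷ (2 , 1) ∷ (1 , 2) ∷ (3 , 1) ∷ []) ((+ 1 , + 0) ∷ [])
            ((+ 0 , + 0) ∷ (+ 0 , + 0) ∷ (+ 0 , + 0) ∷ (+ 1 , -1ℤ) ∷ (+ 1 , -1ℤ) ∷ (-1ℤ , + 2) ∷ (+ 2 , - + 2) ∷ [])
syt4₈ = syt ((1 , 1) ∷ (2 , 1) ∷ (3 , 1) ∷ (1 , 2) ∷ []) []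
            ((+ 0 , + 0) ∷ (+ 0 , + 0) ∷ (+ 0 , + 0) ∷ (+ 1 , -1ℤ) ∷ (+ 1 , - + 2) ∷ (-1ℤ , + 3) ∷ [])
syt4₉ = syt ((1 , 1) ∷ (2 , 1) ∷ (3 , 1) ∷ (4 , 1) ∷ []) []
            ((+ 0 , + 0) ∷ (+ 0 , + 0) ∷ (+ 0 , + 0) ∷ (+ 1 , -1ℤ) ∷ (+ 1 , - + 2) ∷ (+ 1 , - + 3) ∷ [])

table₂ table₃ table₄ : List SimplifiedSYT
table₂ = syt2₀ ∷ syt2₁ ∷ []
table₃ = syt3₀ ∷ syt3₁ ∷ syt3₂ ∷ syt3₃ ∷ []
table₄ = syt4₀ ∷ syt4₁ ∷ syt4₂ ∷ syt4₃ ∷ syt4₄ ∷ syt4₅ ∷ syt4₆ ∷ syt4₇ ∷ syt4₈ ∷ syt4₉ ∷ []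

Fᴱ₂-denotes-F : ∀ a → ⟦ Fᴱ (a ∷ []) table₂ ⟧ ≃ F (a ∷ [])
Fᴱ₂-denotes-F a = Fᴱ-denotes-F (a ∷ []) table₂ refl (refl ∷ refl ∷ [])

Fᴱ₃-denotes-F : ∀ a b → ⟦ Fᴱ (a ∷ b ∷ []) table₃ ⟧ ≃ F (a ∷ b ∷ [])
Fᴱ₃-denotes-F a b = Fᴱ-denotes-F (a ∷ b ∷ []) table₃ refl (refl ∷ refl ∷ refl ∷ refl ∷ [])

Fᴱ₄-denotes-F : ∀ a b c → ⟦ Fᴱ (a ∷ b ∷ c ∷ []) table₄ ⟧ ≃ F (a ∷ b ∷ c ∷ [])
Fᴱ₄-denotes-F a b c = Fᴱ-denotes-F (a ∷ b ∷ c ∷ []) table₄ refl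
  (refl ∷ refl ∷ refl ∷ refl ∷ refl ∷ refl ∷ refl ∷ refl ∷ refl ∷ refl ∷ [])

monoMul-pow-interchange : ∀ z a d m m′ →
  monoMul (monoPow z (a + d)) (monoMul m m′) ≡ monoMul (monoMul (monoPow z a) m) (monoMul (monoPow z d) m′)
monoMul-pow-interchange (x , y) a d (m₁ , m₂) (m₁′ , m₂′) =
  cong₂ _,_ (interchange a d x m₁ m₁′) (interchange a d y m₂ m₂′)
  where
  interchange : ∀ a d x r s → (a + d) * x + (r + s) ≡ (a * x + r) + (d * x + s)
  interchange = solve-∀

zPow-+ : ∀ as ds zs → length as ≡ length ds →
         zPow (zipWith _+_ as ds) zs ≡ monoMul (zPow as zs) (zPow ds zs)
zPow-+ as ds zs = go as ds (drop 1 zs)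
  where
  powProd : List ℤ → List Mono → Mono
  powProd as ws = foldr monoMul monoOne (zipWith (λ a z → monoPow z a) as ws)
  go : ∀ as ds ws → length as ≡ length ds →
       powProd (zipWith _+_ as ds) ws ≡ monoMul (powProd as ws) (powProd ds ws)
  go []       []       ws       _   = refl
  go (a ∷ as) (d ∷ ds) []       _   = refl
  go (a ∷ as) (d ∷ ds) (w ∷ ws) len =
    trans (cong (monoMul (monoPow w (a + d))) (go as ds ws (ℕ.suc-injective len)))
          (monoMul-pow-interchange w a d (powProd as ws) (powProd ds ws))

zPow-snoc : ∀ a b C z₁ z₂ z₃ z →
  zPow (a ∷ b ∷ C ∷ []) (z₁ ∷ z₂ ∷ z₃ ∷ z ∷ [])
    ≡ monoMul (zPow (a ∷ b ∷ []) (z₁ ∷ z₂ ∷ z₃ ∷ [])) (monoPow z C)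
zPow-snoc a b C z₁ (x₂ , y₂) (x₃ , y₃) (x , y) =
  cong₂ _,_ (regroup (a * x₂) (b * x₃) (C * x)) (regroup (a * y₂) (b * y₃) (C * y))
  where
  regroup : ∀ u v w → u + (v + (w + 0ℤ)) ≡ (u + (v + 0ℤ)) + w
  regroup = solve-∀

-- Matches the terms of (qt)^c F(a + c, b - c) with four-box terms of F(a, b, c).
qtShift-zPow : ∀ a b C z₁ z₂ z₃ →
  monoMul (qtPow C) (zPow ((a + C) ∷ (b - C) ∷ []) (z₁ ∷ z₂ ∷ z₃ ∷ []))
    ≡ zPow (a ∷ b ∷ C ∷ []) (z₁ ∷ z₂ ∷ z₃ ∷ monoMul mqt (monoDiv z₂ z₃) ∷ [])
qtShift-zPow a b C z₁ (x₂ , y₂) (x₃ , y₃) = cong₂ _,_ (exponent a b C x₂ x₃) (exponent a b C y₂ y₃)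
  where
  exponent : ∀ a b C x₂ x₃ → C * 1ℤ + ((a + C) * x₂ + ((b - C) * x₃ + 0ℤ))
                           ≡ a * x₂ + (b * x₃ + (C * (1ℤ + (x₂ - x₃)) + 0ℤ))
  exponent = solve-∀

summand-zPow : ∀ a b C I z →
  monoMul (qtPow (b + + 2 * C - + 2 * I)) (zPow ((a - b - + 2 * C + + 4 * I) ∷ []) (monoOne ∷ z ∷ []))
    ≡ monoMul (zPow (a ∷ b ∷ []) (monoOne ∷ z ∷ monoDiv mqt z ∷ []))
              (monoMul (monoPow (monoPow z (+ 2)) I) (monoPow (monoPow (monoDiv mqt z) (+ 2)) (C - I)))
summand-zPow a b C I (x , y) = cong₂ _,_ (exponent a b C I x) (exponent a b C I y)
  where
  exponent : ∀ a b C I x → (b + + 2 * C - + 2 * I) * 1ℤ + ((a - b - + 2 * C + + 4 * I) * x + 0ℤ)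
                         ≡ (a * x + (b * (1ℤ - x) + 0ℤ)) + (I * (+ 2 * x) + (C - I) * (+ 2 * (1ℤ - x)))
  exponent = solve-∀

sumBelowᴱ-cong : ∀ c {f g} → (∀ i → f i ≈ᴱ g i) → sumBelowᴱ c f ≈ᴱ sumBelowᴱ c g
sumBelowᴱ-cong zero    f≈g = ≈ᴱ-refl
sumBelowᴱ-cong (suc c) f≈g = +ᴱ-cong (sumBelowᴱ-cong c f≈g) (f≈g c)

+ᴱ-interchange : ∀ w x y z → (w +ᴱ x) +ᴱ (y +ᴱ z) ≈ᴱ (w +ᴱ y) +ᴱ (x +ᴱ z)
+ᴱ-interchange = solveᴱ 4 (λ w x y z → (w ⊞ x) ⊞ (y ⊞ z) ⊜ (w ⊞ y) ⊞ (x ⊞ z)) ≈ᴱ-refl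

sumBelowᴱ-+ᴱ : ∀ c f g → sumBelowᴱ c (λ i → f i +ᴱ g i) ≈ᴱ sumBelowᴱ c f +ᴱ sumBelowᴱ c g
sumBelowᴱ-+ᴱ zero    f g = ≈ᴱ-sym (+ᴱ-identityˡ 0ᴱ)
sumBelowᴱ-+ᴱ (suc c) f g = ≈ᴱ-trans (+ᴱ-cong (sumBelowᴱ-+ᴱ c f g) ≈ᴱ-refl)
                                    (+ᴱ-interchange (sumBelowᴱ c f) (sumBelowᴱ c g) (f c) (g c))

sumᴸ-cong : ∀ {xs ys} → Pointwise _≈ᴱ_ xs ys → sumᴸ xs ≈ᴱ sumᴸ ys
sumᴸ-cong []             = ≈ᴱ-refl
sumᴸ-cong (x≈y ∷ xs≈ys) = +ᴱ-cong x≈y (sumᴸ-cong xs≈ys)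

sumᴸ-zipWith : ∀ xs ys → length xs ≡ length ys → sumᴸ (zipWith _+ᴱ_ xs ys) ≈ᴱ sumᴸ xs +ᴱ sumᴸ ys
sumᴸ-zipWith []       []       _   = ≈ᴱ-sym (+ᴱ-identityˡ 0ᴱ)
sumᴸ-zipWith (x ∷ xs) (y ∷ ys) len =
  ≈ᴱ-trans (+ᴱ-cong ≈ᴱ-refl (sumᴸ-zipWith xs ys (ℕ.suc-injective len))) (+ᴱ-interchange x y (sumᴸ xs) (sumᴸ ys))

·ᴱ-sumᴸ : ∀ m xs → m ·ᴱ sumᴸ xs ≈ᴱ sumᴸ (map (m ·ᴱ_) xs)
·ᴱ-sumᴸ m []       = ·ᴱ-zeroʳ m
·ᴱ-sumᴸ m (x ∷ xs) = ≈ᴱ-trans (·ᴱ-distrib-+ᴱ m x (sumᴸ xs)) (+ᴱ-cong ≈ᴱ-refl (·ᴱ-sumᴸ m xs))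

geoMono : Mono → Mono → Mono → ℕ → ℕ → Mono
geoMono M α β c i = monoMul M (monoMul (monoPow α (+ i)) (monoPow β (+ c - + i)))

pow-sucˡ : ∀ M γ c → monoMul (monoMul M γ) (monoPow γ (+ c)) ≡ monoMul M (monoPow γ (+ suc c))
pow-sucˡ (m₁ , m₂) (γ₁ , γ₂) c = cong₂ _,_ (exponent m₁ γ₁ (+ c)) (exponent m₂ γ₂ (+ c))
  where
  exponent : ∀ m γ C → (m + γ) + C * γ ≡ m + (1ℤ + C) * γ
  exponent = solve-∀

pow-sucʳ : ∀ M γ c → monoMul (monoMul M (monoPow γ (+ c))) γ ≡ monoMul M (monoPow γ (+ suc c))
pow-sucʳ (m₁ , m₂) (γ₁ , γ₂) c = cong₂ _,_ (exponent m₁ γ₁ (+ c)) (exponent m₂ γ₂ (+ c))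
  where
  exponent : ∀ m γ C → (m + C * γ) + γ ≡ m + (1ℤ + C) * γ
  exponent = solve-∀

pow-swap : ∀ M α β c → monoMul (monoMul M β) (monoPow α (+ c)) ≡ monoMul (monoMul M (monoPow α (+ c))) β
pow-swap (m₁ , m₂) (α₁ , α₂) (β₁ , β₂) c =
  cong₂ _,_ (exponent m₁ α₁ β₁ (+ c)) (exponent m₂ α₂ β₂ (+ c))
  where
  exponent : ∀ m α β C → (m + β) + C * α ≡ (m + C * α) + β
  exponent = solve-∀

geoMono-suc : ∀ M α β c i → geoMono M α β (suc c) i ≡ geoMono (monoMul M β) α β c i
geoMono-suc (m₁ , m₂) (α₁ , α₂) (β₁ , β₂) c i =
  cong₂ _,_ (exponent m₁ α₁ β₁ (+ c) (+ i)) (exponent m₂ α₂ β₂ (+ c) (+ i))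
  where
  exponent : ∀ m α β C I → m + (I * α + ((1ℤ + C) - I) * β) ≡ (m + β) + (I * α + (C - I) * β)
  exponent = solve-∀

geoMono-last : ∀ M α β c → geoMono M α β (suc c) c ≡ monoMul (monoMul M (monoPow α (+ c))) β
geoMono-last (m₁ , m₂) (α₁ , α₂) (β₁ , β₂) c =
  cong₂ _,_ (exponent m₁ α₁ β₁ (+ c)) (exponent m₂ α₂ β₂ (+ c))
  where
  exponent : ∀ m α β C → m + (C * α + ((1ℤ + C) - C) * β) ≡ (m + C * α) + β
  exponent = solve-∀

-- The summands telescope: by the hypotheses, u = (α/β - 1) v′ and v = - v′.
geometric-sum : ∀ {α β u v v′} → v +ᴱ v′ ≈ᴱ 0ᴱ → β ·ᴱ v′ +ᴱ β ·ᴱ u ≈ᴱ α ·ᴱ v′ → ∀ c M →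
  sumBelowᴱ c (λ i → geoMono M α β c i ·ᴱ u)
    ≈ᴱ monoMul M (monoPow β (+ c)) ·ᴱ v +ᴱ monoMul M (monoPow α (+ c)) ·ᴱ v′
geometric-sum {α} {β} {u} {v} {v′} cancel step = go
  where
  open ≈ᴱ-Reasoning
  go : ∀ c M → sumBelowᴱ c (λ i → geoMono M α β c i ·ᴱ u)
               ≈ᴱ monoMul M (monoPow β (+ c)) ·ᴱ v +ᴱ monoMul M (monoPow α (+ c)) ·ᴱ v′
  go zero M = begin
    0ᴱ                 ≈⟨ ·ᴱ-zeroʳ M₀ ⟨
    M₀ ·ᴱ 0ᴱ           ≈⟨ ·ᴱ-cong M₀ cancel ⟨
    M₀ ·ᴱ (v +ᴱ v′)    ≈⟨ ·ᴱ-distrib-+ᴱ M₀ v v′ ⟩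
    M₀ ·ᴱ v +ᴱ M₀ ·ᴱ v′ ∎
    where
    M₀ : Mono
    M₀ = monoMul M (monoPow β (+ 0))
  go (suc c) M = begin
    sumBelowᴱ c (λ i → geoMono M α β (suc c) i ·ᴱ u) +ᴱ geoMono M α β (suc c) c ·ᴱ u
      ≈⟨ +ᴱ-cong (sumBelowᴱ-cong c (λ i → ·ᴱ-congˡ u (geoMono-suc M α β c i))) ≈ᴱ-refl ⟩
    sumBelowᴱ c (λ i → geoMono (monoMul M β) α β c i ·ᴱ u) +ᴱ geoMono M α β (suc c) c ·ᴱ u
      ≈⟨ +ᴱ-cong (go c (monoMul M β)) (·ᴱ-congˡ u (geoMono-last M α β c)) ⟩
    (monoMul (monoMul M β) (monoPow β (+ c)) ·ᴱ v +ᴱ monoMul (monoMul M β) (monoPow α (+ c)) ·ᴱ v′)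
      +ᴱ monoMul K β ·ᴱ u
      ≈⟨ +ᴱ-assoc _ _ _ ⟩
    monoMul (monoMul M β) (monoPow β (+ c)) ·ᴱ v
      +ᴱ (monoMul (monoMul M β) (monoPow α (+ c)) ·ᴱ v′ +ᴱ monoMul K β ·ᴱ u)
      ≡⟨ cong₂ (λ m m′ → m ·ᴱ v +ᴱ (m′ ·ᴱ v′ +ᴱ monoMul K β ·ᴱ u)) (pow-sucˡ M β c) (pow-swap M α β c) ⟩
    monoMul M (monoPow β (+ suc c)) ·ᴱ v +ᴱ (monoMul K β ·ᴱ v′ +ᴱ monoMul K β ·ᴱ u)
      ≈⟨ +ᴱ-cong ≈ᴱ-refl (+ᴱ-cong (·ᴱ-assoc K β v′) (·ᴱ-assoc K β u)) ⟨
    monoMul M (monoPow β (+ suc c)) ·ᴱ v +ᴱ (K ·ᴱ β ·ᴱ v′ +ᴱ K ·ᴱ β ·ᴱ u)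
      ≈⟨ +ᴱ-cong ≈ᴱ-refl (·ᴱ-distrib-+ᴱ K (β ·ᴱ v′) (β ·ᴱ u)) ⟨
    monoMul M (monoPow β (+ suc c)) ·ᴱ v +ᴱ K ·ᴱ (β ·ᴱ v′ +ᴱ β ·ᴱ u)
      ≈⟨ +ᴱ-cong ≈ᴱ-refl (≈ᴱ-trans (·ᴱ-cong K step) (·ᴱ-assoc K α v′)) ⟩
    monoMul M (monoPow β (+ suc c)) ·ᴱ v +ᴱ monoMul K α ·ᴱ v′
      ≡⟨ cong (λ m → monoMul M (monoPow β (+ suc c)) ·ᴱ v +ᴱ m ·ᴱ v′) (pow-sucʳ M α c) ⟩
    monoMul M (monoPow β (+ suc c)) ·ᴱ v +ᴱ monoMul M (monoPow α (+ suc c)) ·ᴱ v′ ∎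
    where
    K : Mono
    K = monoMul M (monoPow α (+ c))

term-zipWith-+ : ∀ as ds s → length as ≡ length ds →
  term (zipWith _+_ as ds) s ≈ᴱ zPow as (zsOf s) ·ᴱ zPow ds (zsOf s) ·ᴱ weightᴱ s
term-zipWith-+ as ds s len =
  ≈ᴱ-trans (·ᴱ-congˡ (weightᴱ s) (zPow-+ as ds (zsOf s) len)) (≈ᴱ-sym (·ᴱ-assoc _ _ (weightᴱ s)))

module Recurrence (a b : ℤ) (c : ℕ) where

  as as′ as₃ : List ℤ
  as  = a ∷ b ∷ + c ∷ []
  as′ = (a + 1ℤ) ∷ (b + 1ℤ) ∷ (+ c - 1ℤ) ∷ []
  as₃ = (a + + c) ∷ (b - + c) ∷ []

  K : SimplifiedSYT → Mono
  K s = zPow as (zsOf s)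

  δ : SimplifiedSYT → Mono
  δ s = zPow (1ℤ ∷ 1ℤ ∷ -1ℤ ∷ []) (zsOf s)

  tableau-step : ∀ s {E} e → E ≈ᴱ K s ·ᴱ e → weightᴱ s ≈ᴿ? (δ s ·ᴱ weightᴱ s +ᴱ e) ≡ true →
                 term as s ≈ᴱ term as′ s +ᴱ E
  tableau-step s {E} e E≈ check = begin
    K s ·ᴱ weightᴱ s                           ≈⟨ ·ᴱ-cong (K s) (≈ᴱ-check _ _ check) ⟩
    K s ·ᴱ (δ s ·ᴱ weightᴱ s +ᴱ e)             ≈⟨ ·ᴱ-distrib-+ᴱ (K s) _ e ⟩
    K s ·ᴱ δ s ·ᴱ weightᴱ s +ᴱ K s ·ᴱ e        ≈⟨ +ᴱ-cong (term-zipWith-+ as (1ℤ ∷ 1ℤ ∷ -1ℤ ∷ []) s refl) E≈ ⟨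
    term as′ s +ᴱ E                           ∎
    where open ≈ᴱ-Reasoning

  Q : SimplifiedSYT → RatExpr
  Q s = qtPow (+ c) ·ᴱ term as₃ s

  Q-shift : ∀ s z₁ z₂ z₃ → qtPow (+ c) ·ᴱ zPow as₃ (z₁ ∷ z₂ ∷ z₃ ∷ []) ·ᴱ weightᴱ s
                         ≈ᴱ zPow as (z₁ ∷ z₂ ∷ z₃ ∷ monoMul mqt (monoDiv z₂ z₃) ∷ []) ·ᴱ weightᴱ s
  Q-shift s z₁ z₂ z₃ =
    ≈ᴱ-trans (·ᴱ-assoc _ _ (weightᴱ s)) (·ᴱ-congˡ (weightᴱ s) (qtShift-zPow a b (+ c) z₁ z₂ z₃))

  snoc-shift : ∀ z₁ z₂ z₃ z x → monoMul (zPow (a ∷ b ∷ []) (z₁ ∷ z₂ ∷ z₃ ∷ [])) (monoPow z (+ c)) ·ᴱ x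
                              ≈ᴱ zPow as (z₁ ∷ z₂ ∷ z₃ ∷ z ∷ []) ·ᴱ x
  snoc-shift z₁ z₂ z₃ z x = ·ᴱ-congˡ x (sym (zPow-snoc a b (+ c) z₁ z₂ z₃ z))

  q² t² : Mono
  q² = (+ 2 , + 0)
  t² = (+ 0 , + 2)

  Mq Mt : Mono
  Mq = zPow (a ∷ b ∷ []) (zsOf syt3₁)
  Mt = zPow (a ∷ b ∷ []) (zsOf syt3₂)

  -- With α, β = q², t² (resp. t², q²) and u the weight of the two-box row (resp. column),
  -- v′ = β u / (α - β) and v = - v′.
  vq vq′ vt vt′ : RatExpr
  vq′ = lit (pMono (- + 2 , + 2)) ÷ ((- + 2 , + 2) ∷ (-1ℤ , + 1) ∷ [])
  vq  = lit ((-1ℤ , (- + 2 , + 2)) ∷ []) ÷ ((- + 2 , + 2) ∷ (-1ℤ , + 1) ∷ [])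
  vt′ = lit (pMono (+ 2 , - + 2)) ÷ ((+ 2 , - + 2) ∷ (+ 1 , -1ℤ) ∷ [])
  vt  = lit ((-1ℤ , (+ 2 , - + 2)) ∷ []) ÷ ((+ 2 , - + 2) ∷ (+ 1 , -1ℤ) ∷ [])

  gq gq′ gt gt′ : RatExpr
  gq  = monoMul Mq (monoPow t² (+ c)) ·ᴱ vq
  gq′ = monoMul Mq (monoPow q² (+ c)) ·ᴱ vq′
  gt  = monoMul Mt (monoPow q² (+ c)) ·ᴱ vt
  gt′ = monoMul Mt (monoPow t² (+ c)) ·ᴱ vt′

  defects : List RatExpr
  defects =
    0ᴱ ∷ Q syt3₀ ∷ Q syt3₁ +ᴱ gq′ ∷ 0ᴱ ∷ gq ∷ gt ∷ 0ᴱ ∷ Q syt3₂ +ᴱ gt′ ∷ Q syt3₃ ∷ 0ᴱ ∷ []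

  factor-+ᴱ : ∀ {m x y x′ y′} → x ≈ᴱ m ·ᴱ x′ → y ≈ᴱ m ·ᴱ y′ → x +ᴱ y ≈ᴱ m ·ᴱ (x′ +ᴱ y′)
  factor-+ᴱ {m} {x′ = x′} {y′} x≈ y≈ = ≈ᴱ-trans (+ᴱ-cong x≈ y≈) (≈ᴱ-sym (·ᴱ-distrib-+ᴱ m x′ y′))

  tableau-steps : Pointwise _≈ᴱ_ (map (term as) table₄) (zipWith _+ᴱ_ (map (term as′) table₄) defects)
  tableau-steps =
      tableau-step syt4₀ 0ᴱ (≈ᴱ-sym (·ᴱ-zeroʳ _)) refl
    ∷ tableau-step syt4₁ (weightᴱ syt3₀) (Q-shift syt3₀ (+ 0 , + 0) (+ 1 , + 0) (+ 2 , + 0)) refl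
    ∷ tableau-step syt4₂ (weightᴱ syt3₁ +ᴱ vq′)
        (factor-+ᴱ (Q-shift syt3₁ (+ 0 , + 0) (+ 1 , + 0) (+ 0 , + 1))
                   (snoc-shift (+ 0 , + 0) (+ 1 , + 0) (+ 0 , + 1) q² vq′))
        refl
    ∷ tableau-step syt4₃ 0ᴱ (≈ᴱ-sym (·ᴱ-zeroʳ _)) refl
    ∷ tableau-step syt4₄ vq (snoc-shift (+ 0 , + 0) (+ 1 , + 0) (+ 0 , + 1) t² vq) refl
    ∷ tableau-step syt4₅ vt (snoc-shift (+ 0 , + 0) (+ 0 , + 1) (+ 1 , + 0) q² vt) refl
    ∷ tableau-step syt4₆ 0ᴱ (≈ᴱ-sym (·ᴱ-zeroʳ _)) refl
    ∷ tableau-step syt4₇ (weightᴱ syt3₂ +ᴱ vt′)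
        (factor-+ᴱ (Q-shift syt3₂ (+ 0 , + 0) (+ 0 , + 1) (+ 1 , + 0))
                   (snoc-shift (+ 0 , + 0) (+ 0 , + 1) (+ 1 , + 0) t² vt′))
        refl
    ∷ tableau-step syt4₈ (weightᴱ syt3₃) (Q-shift syt3₃ (+ 0 , + 0) (+ 0 , + 1) (+ 0 , + 2)) refl
    ∷ tableau-step syt4₉ 0ᴱ (≈ᴱ-sym (·ᴱ-zeroʳ _)) refl
    ∷ []

  defects-sum : sumᴸ defects ≈ᴱ qtPow (+ c) ·ᴱ Fᴱ as₃ table₃ +ᴱ ((gq +ᴱ gq′) +ᴱ (gt +ᴱ gt′))
  defects-sum = begin
    sumᴸ defects
      ≈⟨ solveᴱ 8 (λ q₀ q₁ q₂ q₃ g g′ h h′ →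
           ∅ ⊞ (q₀ ⊞ ((q₁ ⊞ g′) ⊞ (∅ ⊞ (g ⊞ (h ⊞ (∅ ⊞ ((q₂ ⊞ h′) ⊞ (q₃ ⊞ (∅ ⊞ ∅))))))))) ⊜
           (q₀ ⊞ (q₁ ⊞ (q₂ ⊞ (q₃ ⊞ ∅)))) ⊞ ((g ⊞ g′) ⊞ (h ⊞ h′)))
         ≈ᴱ-refl (Q syt3₀) (Q syt3₁) (Q syt3₂) (Q syt3₃) gq gq′ gt gt′ ⟩
    sumᴸ (map (qtPow (+ c) ·ᴱ_) (map (term as₃) table₃)) +ᴱ ((gq +ᴱ gq′) +ᴱ (gt +ᴱ gt′))
      ≈⟨ +ᴱ-cong (·ᴱ-sumᴸ (qtPow (+ c)) (map (term as₃) table₃)) ≈ᴱ-refl ⟨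
    qtPow (+ c) ·ᴱ Fᴱ as₃ table₃ +ᴱ ((gq +ᴱ gq′) +ᴱ (gt +ᴱ gt′)) ∎
    where open ≈ᴱ-Reasoning

  summand : ℕ → RatExpr
  summand i = qtPow (b + + 2 * + c - + 2 * + i) ·ᴱ Fᴱ ((a - b - + 2 * + c + + 4 * + i) ∷ []) table₂

  summand-split : ∀ i →
    summand i ≈ᴱ geoMono Mq q² t² c i ·ᴱ weightᴱ syt2₀ +ᴱ geoMono Mt t² q² c i ·ᴱ weightᴱ syt2₁
  summand-split i = begin
    summand i
      ≈⟨ ·ᴱ-sumᴸ m (map (term aᵢ) table₂) ⟩
    m ·ᴱ term aᵢ syt2₀ +ᴱ (m ·ᴱ term aᵢ syt2₁ +ᴱ 0ᴱ)
      ≈⟨ +ᴱ-cong (row (+ 1 , + 0) syt2₀) (≈ᴱ-trans (+ᴱ-identityʳ _) (row (+ 0 , + 1) syt2₁)) ⟩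
    geoMono Mq q² t² c i ·ᴱ weightᴱ syt2₀ +ᴱ geoMono Mt t² q² c i ·ᴱ weightᴱ syt2₁ ∎
    where
    open ≈ᴱ-Reasoning
    m : Mono
    m = qtPow (b + + 2 * + c - + 2 * + i)
    aᵢ : List ℤ
    aᵢ = (a - b - + 2 * + c + + 4 * + i) ∷ []
    row : ∀ z s → m ·ᴱ zPow aᵢ (monoOne ∷ z ∷ []) ·ᴱ weightᴱ s
                  ≈ᴱ geoMono (zPow (a ∷ b ∷ []) (monoOne ∷ z ∷ monoDiv mqt z ∷ []))
                             (monoPow z (+ 2)) (monoPow (monoDiv mqt z) (+ 2)) c i ·ᴱ weightᴱ s
    row z s = ≈ᴱ-trans (·ᴱ-assoc _ _ (weightᴱ s)) (·ᴱ-congˡ (weightᴱ s) (summand-zPow a b (+ c) (+ i) z))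

  summands : sumBelowᴱ c summand ≈ᴱ (gq +ᴱ gq′) +ᴱ (gt +ᴱ gt′)
  summands = begin
    sumBelowᴱ c summand
      ≈⟨ sumBelowᴱ-cong c summand-split ⟩
    sumBelowᴱ c (λ i → geoMono Mq q² t² c i ·ᴱ weightᴱ syt2₀ +ᴱ geoMono Mt t² q² c i ·ᴱ weightᴱ syt2₁)
      ≈⟨ sumBelowᴱ-+ᴱ c _ _ ⟩
    sumBelowᴱ c (λ i → geoMono Mq q² t² c i ·ᴱ weightᴱ syt2₀)
      +ᴱ sumBelowᴱ c (λ i → geoMono Mt t² q² c i ·ᴱ weightᴱ syt2₁)
      ≈⟨ +ᴱ-cong (geometric-sum (≈ᴱ-check (vq +ᴱ vq′) 0ᴱ refl) (≈ᴱ-check _ _ refl) c Mq)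
                 (geometric-sum (≈ᴱ-check (vt +ᴱ vt′) 0ᴱ refl) (≈ᴱ-check _ _ refl) c Mt) ⟩
    (gq +ᴱ gq′) +ᴱ (gt +ᴱ gt′) ∎
    where open ≈ᴱ-Reasoning

  rhsᴱ : RatExpr
  rhsᴱ = (Fᴱ as′ table₄ +ᴱ qtPow (+ c) ·ᴱ Fᴱ as₃ table₃)
         +ᴱ sumBelowᴱ c summand

  recurrenceᴱ : Fᴱ as table₄ ≈ᴱ rhsᴱ
  recurrenceᴱ = begin
    Fᴱ as table₄
      ≈⟨ sumᴸ-cong tableau-steps ⟩
    sumᴸ (zipWith _+ᴱ_ (map (term as′) table₄) defects)
      ≈⟨ sumᴸ-zipWith (map (term as′) table₄) defects refl ⟩
    Fᴱ as′ table₄ +ᴱ sumᴸ defects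
      ≈⟨ +ᴱ-cong ≈ᴱ-refl (≈ᴱ-trans defects-sum (+ᴱ-cong ≈ᴱ-refl (≈ᴱ-sym summands))) ⟩
    Fᴱ as′ table₄ +ᴱ (qtPow (+ c) ·ᴱ Fᴱ as₃ table₃ +ᴱ sumBelowᴱ c summand)
      ≈⟨ +ᴱ-assoc _ _ _ ⟨
    (Fᴱ as′ table₄ +ᴱ qtPow (+ c) ·ᴱ Fᴱ as₃ table₃) +ᴱ sumBelowᴱ c summand ∎
    where open ≈ᴱ-Reasoning

corollary2p21 : (a b : ℤ) (c : ℕ) →
    F (a ∷ b ∷ + c ∷ []) ≈R
      F ((a + 1ℤ) ∷ (b + 1ℤ) ∷ (+ c - 1ℤ) ∷ [])
      +R monoR (qtPow (+ c)) (F ((a + + c) ∷ (b - + c) ∷ []))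
      +R sumBelow c (λ i → monoR (qtPow (b + + 2 * + c - + 2 * + i))
                                 (F ((a - b - + 2 * + c + + 4 * + i) ∷ [])))
corollary2p21 a b c = coeff-≡ (cross-≋ (
  ≃-via (Fᴱ (a ∷ b ∷ + c ∷ []) table₄) (≃-sym (Fᴱ₄-denotes-F a b (+ c)))
    (≃-via rhsᴱ (≈ᴱ⇒≃ recurrenceᴱ)
      (⟦⟧-+ᴱ (⟦⟧-+ᴱ (Fᴱ₄-denotes-F (a + 1ℤ) (b + 1ℤ) (+ c - 1ℤ))
                    (⟦⟧-·ᴱ (qtPow (+ c)) (Fᴱ₃-denotes-F (a + + c) (b - + c))))
             (⟦⟧-sumBelowᴱ c λ i → ⟦⟧-·ᴱ (qtPow (b + + 2 * + c - + 2 * + i))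
                                         (Fᴱ₂-denotes-F (a - b - + 2 * + c + + 4 * + i)))))))
  where open Recurrence a b c
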